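{- Let $R$ be a unique factorization domain, $p\in R$ a prime element, $g,h$ nonconstant algebraically primitive Dirichlet polynomials with coefficients in $R$, and $f=g\cdot h$. Then the Newton log-polygon of $f$ with respect to $p$ is obtained from translates of the edges of the Newton log-polygons of $g$ and $h$ with respect to $p$, using exactly one translate of each edge, arranged into a polygonal line with increasing slopes from left to right. Equivalently: the set of slopes of edges of the Newton log-polygon of $f$ is the union of the sets of slopes of edges of the Newton log-polygons of $g$ and $h$, and for each such slope $S$, the vector of the edge of slope $S$ of the Newton log-polygon of $f$ equals the sum of the vectors of the edges of slope $S$ of the Newton log-polygons of $g$ and $h$ (an absent edge contributing zero).
   Context: Dirichlet polynomials $\sum_i \frac{A_i}{i^s}$ are multiplied by the Dirichlet product $\left(\sum_j\frac{b_j}{j^s}\right)\left(\sum_k\frac{c_k}{k^s}\right)=\sum_i\frac{\sum_{jk=i}b_jc_k}{i^s}$; constant means supported on $\{1\}$; algebraically primitive means the indices $i$ with $A_i\neq0$ have gcd $1$. For $f=\frac{A_m}{m^s}+\cdots+\frac{A_n}{n^s}$ with $A_mA_n\neq0$, $m<n$, and $\nu_p$ the $p$-adic valuation, the Newton log-polygon of $f$ with respect to $p$ is the lower convex hull of the points $(\log i,\nu_p(A_i))$ for $A_i\neq 0$, i.e. the polygonal line $P_1P_2\cdots P_r$ from $P_1=(\log m,\nu_p(A_m))$ to $P_r=(\log n,\nu_p(A_n))$ where each $P_{j+1}=(\log i,\nu_p(A_i))$ is chosen with $i$ the largest index such that no point $(\log i',\nu_p(A_{i'}))$ lies strictly below the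 line $P_jP_{j+1}$. The segments $P_jP_{j+1}$ are its edges, and $\overrightarrow{P_jP_{j+1}}$ their vectors. -}

module Defs where

open import Level using (Level; _⊔_)
open import Algebra.Bundles using (CommutativeRing)
open import Data.Nat as ℕ using (ℕ; zero; suc; _<_; _≤_)
open import Data.Nat.Divisibility as ℕD using ()
open import Data.Integer as ℤ using (ℤ; +_; -[1+_])
open import Data.Product using (Σ; ∃; ∃-syntax; _×_; _,_; proj₁; proj₂)
open import Data.Sum using (_⊎_)
open import Data.List using (List; []; _∷_; foldr; map; applyUpTo; length)
open import Data.List.Membership.Propositional using (_∈_)
open import Data.List.Relation.Binary.Pointwise using (Pointwise)
open import Data.List.Relation.Binary.Permutation.Propositional using (_↭_)
open import Data.List.Relation.Unary.All using (All)
open import Data.Bool using (if_then_else_)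
open import Data.Empty using (⊥)
open import Relation.Nullary using (¬_; does)
open import Relation.Binary.PropositionalEquality using (_≡_)

-- A "power product" is a list of (base , exponent) with base ≥ 1 and
-- exponent ∈ ℤ, standing for the positive rational  Π base ^ exponent.

posPart : ℤ → ℕ
posPart (+ n)    = n
posPart -[1+ n ] = 0

negPart : ℤ → ℕ
negPart (+ n)    = 0
negPart -[1+ n ] = suc n

prodPos : List (ℕ × ℤ) → ℕ
prodPos = foldr (λ be r → proj₁ be ℕ.^ posPart (proj₂ be) ℕ.* r) 1

prodNeg : List (ℕ × ℤ) → ℕ
prodNeg = foldr (λ be r → proj₁ be ℕ.^ negPart (proj₂ be) ℕ.* r) 1

-- Π_L b^e = Π_R b^e   (as positive rationals), cleared of denominators
PowEq : List (ℕ × ℤ) → List (ℕ × ℤ) → Set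
PowEq L R = prodPos L ℕ.* prodNeg R ≡ prodPos R ℕ.* prodNeg L

PowLt : List (ℕ × ℤ) → List (ℕ × ℤ) → Set
PowLt L R = prodPos L ℕ.* prodNeg R < prodPos R ℕ.* prodNeg L

-- Log-plane geometry.  A point (i , v) with i ≥ 1 stands for the point
-- (log i , v) of the real plane.

Pt : Set
Pt = ℕ × ℕ

idx : Pt → ℕ
idx = proj₁

val : Pt → ℤ
val P = + proj₂ P

-- For idx A < idx B: the point C lies strictly below the line AB, i.e.
--   (v_C - v_A) (log b - log a) < (v_B - v_A) (log c - log a),
-- exponentiated:  (b/a)^(v_C - v_A) < (c/a)^(v_B - v_A).
StrictlyBelow : Pt → Pt → Pt → Set
StrictlyBelow A B C =
  PowLt ((idx B , x) ∷ (idx A , ℤ.- x) ∷ [])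
        ((idx C , y) ∷ (idx A , ℤ.- y) ∷ [])
  where
  x = val C ℤ.- val A
  y = val B ℤ.- val A

Edge : Set
Edge = Pt × Pt

edges : List Pt → List Edge
edges []           = []
edges (P ∷ [])     = []
edges (P ∷ Q ∷ qs) = (P , Q) ∷ edges (Q ∷ qs)

rise : Edge → ℤ
rise (A , B) = val B ℤ.- val A

-- slope(E₁) = slope(E₂), where slope(A,B) = (v_B - v_A)/(log b - log a):
--   rise₁ (log b₂ - log a₂) = rise₂ (log b₁ - log a₁), exponentiated.
SameSlope : Edge → Edge → Set
SameSlope E₁@(A₁ , B₁) E₂@(A₂ , B₂) =
  PowEq ((idx B₂ , rise E₁) ∷ (idx A₂ , ℤ.- rise E₁) ∷ [])
        ((idx B₁ , rise E₂) ∷ (idx A₁ , ℤ.- rise E₂) ∷ [])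

-- vec E = vec G, vec E = (log b - log a , v_B - v_A)
VecEq : Edge → Edge → Set
VecEq E@(A , B) G@(C , D) =
  (idx B ℕ.* idx C ≡ idx A ℕ.* idx D) × (rise E ≡ rise G)

-- vec E = vec G + vec H
VecSum : Edge → Edge → Edge → Set
VecSum E@(A , B) G@(C , D) H@(C' , D') =
  (idx B ℕ.* (idx C ℕ.* idx C') ≡ idx A ℕ.* (idx D ℕ.* idx D'))
  × (rise E ≡ rise G ℤ.+ rise H)

SlopeIn : Edge → List Pt → Set
SlopeIn E N = ∃[ G ] (G ∈ edges N × SameSlope E G)

NoSlopeIn : Edge → List Pt → Set
NoSlopeIn E N = ∀ G → G ∈ edges N → ¬ SameSlope E G

PolygonSum : List Pt → List Pt → List Pt → Set
PolygonSum Nf Ng Nh =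
    (∀ E → E ∈ edges Nf → SlopeIn E Ng ⊎ SlopeIn E Nh)
  × (∀ G → G ∈ edges Ng → SlopeIn G Nf)
  × (∀ H → H ∈ edges Nh → SlopeIn H Nf)
  × (∀ E → E ∈ edges Nf →
        (∃[ G ] ∃[ H ] (G ∈ edges Ng × SameSlope E G
                      × H ∈ edges Nh × SameSlope E H × VecSum E G H))
      ⊎ (∃[ G ] (G ∈ edges Ng × SameSlope E G × NoSlopeIn E Nh × VecEq E G))
      ⊎ (∃[ H ] (H ∈ edges Nh × SameSlope E H × NoSlopeIn E Ng × VecEq E H)))

module Ring {c ℓ : Level} (R : CommutativeRing c ℓ) where
  open CommutativeRing R

  _∣_ : Carrier → Carrier → Set (c ⊔ ℓ)
  a ∣ b = ∃[ q ] (b ≈ a * q)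

  IsUnit : Carrier → Set (c ⊔ ℓ)
  IsUnit a = ∃[ b ] (a * b ≈ 1#)

  Associated : Carrier → Carrier → Set (c ⊔ ℓ)
  Associated a b = ∃[ u ] (IsUnit u × a ≈ u * b)

  Irreducible : Carrier → Set (c ⊔ ℓ)
  Irreducible a = ¬ (a ≈ 0#) × ¬ IsUnit a
                × (∀ b d → a ≈ b * d → IsUnit b ⊎ IsUnit d)

  IsPrime : Carrier → Set (c ⊔ ℓ)
  IsPrime p = ¬ (p ≈ 0#) × ¬ IsUnit p
            × (∀ a b → p ∣ (a * b) → p ∣ a ⊎ p ∣ b)

  prod : List Carrier → Carrier
  prod = foldr _*_ 1#

  record IsUFD : Set (c ⊔ ℓ) where
    field
      nontrivial : ¬ (1# ≈ 0#)
      noZeroDivisors : ∀ a b → a * b ≈ 0# → a ≈ 0# ⊎ b ≈ 0#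
      factorization : ∀ a → ¬ (a ≈ 0#) → ¬ IsUnit a →
        ∃[ xs ] (All Irreducible xs × a ≈ prod xs)
      uniqueness : ∀ xs ys → All Irreducible xs → All Irreducible ys →
        prod xs ≈ prod ys →
        ∃[ zs ] (zs ↭ ys × Pointwise Associated xs zs)

  _^_ : Carrier → ℕ → Carrier
  a ^ zero  = 1#
  a ^ suc n = a * (a ^ n)

  Val : Carrier → Carrier → ℕ → Set (c ⊔ ℓ)
  Val p a k = (p ^ k) ∣ a × ¬ ((p ^ suc k) ∣ a)

  -- Dirichlet polynomial: list [A₁ , A₂ , … , A_N] standing for Σ Aᵢ / i^s
  DirPoly : Set c
  DirPoly = List Carrier

  lookup0 : DirPoly → ℕ → Carrier
  lookup0 []       k       = 0#
  lookup0 (x ∷ xs) zero    = x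
  lookup0 (x ∷ xs) (suc k) = lookup0 xs k

  -- coefficient A_i  (A_0 = 0 by convention; indices start at 1)
  coeff : DirPoly → ℕ → Carrier
  coeff f zero    = 0#
  coeff f (suc k) = lookup0 f k

  sumR : List Carrier → Carrier
  sumR = foldr _+_ 0#

  dcoeff : DirPoly → DirPoly → ℕ → Carrier
  dcoeff g h i =
    sumR (applyUpTo (λ j′ → sumR (applyUpTo (λ k′ →
      let j = suc j′ ; k = suc k′ in
      if does (j ℕ.* k ℕ.≟ i) then coeff g j * coeff h k else 0#) i)) i)

  _⊛_ : DirPoly → DirPoly → DirPoly
  g ⊛ h = applyUpTo (λ i′ → dcoeff g h (suc i′)) (length g ℕ.* length h)

  Supp : DirPoly → ℕ → Set ℓ
  Supp f i = ¬ (coeff f i ≈ 0#)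

  NonConstant : DirPoly → Set ℓ
  NonConstant f = ∃[ i ] (2 ≤ i × Supp f i)

  AlgPrimitive : DirPoly → Set ℓ
  AlgPrimitive f = ∀ d → (∀ i → Supp f i → d ℕD.∣ i) → d ≡ 1

  module Newton (p : Carrier) (f : DirPoly) where

    IsPoint : Pt → Set (c ⊔ ℓ)
    IsPoint P = Supp f (idx P) × Val p (coeff f (idx P)) (proj₂ P)

    NoneBelow : Pt → Pt → Set (c ⊔ ℓ)
    NoneBelow P Q = ∀ C → IsPoint C → ¬ StrictlyBelow P Q C

    NextVertex : Pt → Pt → Set (c ⊔ ℓ)
    NextVertex P Q = IsPoint Q × idx P < idx Q × NoneBelow P Q
                   × (∀ C → IsPoint C → idx Q < idx C → ¬ NoneBelow P C)

    data Chain : Pt → List Pt → Set (c ⊔ ℓ) where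
      last : ∀ {P} → (∀ i → Supp f i → i ≤ idx P) → Chain P []
      next : ∀ {P Q qs} → NextVertex P Q → Chain Q qs → Chain P (Q ∷ qs)

    IsNewtonPolygon : List Pt → Set (c ⊔ ℓ)
    IsNewtonPolygon []       = Level.Lift _ ⊥
    IsNewtonPolygon (P ∷ qs) = IsPoint P × (∀ i → Supp f i → idx P ≤ i)
                             × Chain P qs

{-# OPTIONS --safe #-}
module Submission where

-- The log-plane is handled multiplicatively: the point (log i , v) is kept as (i , v),
-- and a quantity a log x + r log y becomes the positive rational x^a y^r, so that slopes
-- and heights are compared exactly.
--
-- For the direction D of a segment, the height of a point is the linear form vanishing
-- on D. The lowest points of a polynomial form a face, with a left and a right end, and
-- the edges of the Newton polygon are exactly its faces of positive length. Heights add
-- under the product of points (i , v) (j , w) ↦ (ij , v + w), and the coefficient of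
-- g ⊛ h at index i is the sum of the g_j h_k with jk = i. So no point of g ⊛ h lies below
-- the sum of the lowest heights of g and h, and at the product of the left (or right)
-- ends of the faces of g and h a single term has the least valuation, which, p being
-- prime, is then the valuation of the coefficient. Hence the face of g ⊛ h in direction
-- D is the sum of the faces of g and h, which gives both the slopes and the vectors of
-- its edges.

open import Defs
open import Level using (Level)
open import Algebra.Bundles using (CommutativeRing)
open import Data.List using (List)

module PositiveRational where

  open import Data.Nat as ℕ using (ℕ; zero; suc; NonZero; _*_)
  import Data.Nat.Properties as ℕ
  open import Data.Nat.Tactic.RingSolver using (solve-∀)
  open import Data.Integer as ℤ using (ℤ; +_; -[1+_])
  import Data.Integer.Properties as ℤ
  import Data.Integer.Tactic.RingSolver as ℤ-Solver
  open import Data.Product using (_,_)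
  open import Function using (_∘_)
  open import Relation.Binary.Definitions using (tri<; tri≈; tri>; Trichotomous)
  open import Relation.Binary.Structures using (IsEquivalence; IsPreorder)
  open import Relation.Nullary using (¬_)
  open import Relation.Binary.PropositionalEquality

  infix  8 _⁻¹
  infixr 8 _^_
  infixl 7 _·_
  infix  4 _≈_ _<_ _≤_

  record ℚ⁺ : Set where
    constructor _/_
    field
      num den : ℕ
      .{{num≢0}} : NonZero num
      .{{den≢0}} : NonZero den
  open ℚ⁺ public

  den-nonZero : (x : ℚ⁺) → NonZero (den x)
  den-nonZero (_ / suc _) = _

  record _≈_ (x y : ℚ⁺) : Set where
    constructor *≡*
    field cross : num x * den y ≡ num y * den x

  record _<_ (x y : ℚ⁺) : Set where
    constructor *<*
    field cross : num x * den y ℕ.< num y * den x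

  record _≤_ (x y : ℚ⁺) : Set where
    constructor *≤*
    field cross : num x * den y ℕ.≤ num y * den x

  1ℚ⁺ : ℚ⁺
  1ℚ⁺ = 1 / 1

  _·_ : ℚ⁺ → ℚ⁺ → ℚ⁺
  (a / b) · (c / d) = _/_ (a * c) (b * d) {{ℕ.m*n≢0 a c}} {{ℕ.m*n≢0 b d}}

  _⁻¹ : ℚ⁺ → ℚ⁺
  (a / b) ⁻¹ = b / a

  _^_ : ℚ⁺ → ℤ → ℚ⁺
  (a / b) ^ r = _/_ (a ℕ.^ posPart r * b ℕ.^ negPart r) (b ℕ.^ posPart r * a ℕ.^ negPart r)
    {{ℕ.m*n≢0 _ _ {{ℕ.m^n≢0 a (posPart r)}} {{ℕ.m^n≢0 b (negPart r)}}}}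
    {{ℕ.m*n≢0 _ _ {{ℕ.m^n≢0 b (posPart r)}} {{ℕ.m^n≢0 a (negPart r)}}}}

  -- fromℕ 0 is a junk value, so fromℕ is multiplicative only on positive arguments.
  fromℕ : ℕ → ℚ⁺
  fromℕ zero    = 1ℚ⁺
  fromℕ (suc n) = suc n / 1

  ≈-refl : ∀ {x} → x ≈ x
  ≈-refl = *≡* refl

  ≈-reflexive : ∀ {x y} → x ≡ y → x ≈ y
  ≈-reflexive refl = ≈-refl

  ≈-sym : ∀ {x y} → x ≈ y → y ≈ x
  ≈-sym (*≡* e) = *≡* (sym e)

  private
    swap₂₃ : ∀ a b c → a * b * c ≡ a * c * b
    swap₂₃ = solve-∀

    swap₁₂ : ∀ a b c → a * b * c ≡ b * (a * c)
    swap₁₂ = solve-∀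

    interchange : ∀ a b c d → a * b * (c * d) ≡ a * c * (b * d)
    interchange = solve-∀

    drop-ones : ∀ a b → a * 1 * (b * 1) ≡ a * b
    drop-ones = solve-∀

  ≈-trans : ∀ {x y z} → x ≈ y → y ≈ z → x ≈ z
  ≈-trans {x} {y} {z} (*≡* e₁) (*≡* e₂) = *≡* (ℕ.*-cancelʳ-≡ _ _ (den y) {{den-nonZero y}} (begin
    num x * den z * den y   ≡⟨ swap₂₃ (num x) (den z) (den y) ⟩
    num x * den y * den z   ≡⟨ cong (_* den z) e₁ ⟩
    num y * den x * den z   ≡⟨ swap₁₂ (num y) (den x) (den z) ⟩
    den x * (num y * den z) ≡⟨ cong (den x *_) e₂ ⟩
    den x * (num z * den y) ≡⟨ swap₁₂ (num z) (den x) (den y) ⟨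
    num z * den x * den y   ∎))
    where open ≡-Reasoning

  ≈-isEquivalence : IsEquivalence _≈_
  ≈-isEquivalence = record { refl = ≈-refl ; sym = ≈-sym ; trans = ≈-trans }

  <⇒≤ : ∀ {x y} → x < y → x ≤ y
  <⇒≤ (*<* lt) = *≤* (ℕ.<⇒≤ lt)

  ≤-reflexive : ∀ {x y} → x ≈ y → x ≤ y
  ≤-reflexive (*≡* e) = *≤* (ℕ.≤-reflexive e)

  <-irrefl : ∀ {x y} → x ≈ y → ¬ x < y
  <-irrefl (*≡* e) (*<* lt) = ℕ.<-irrefl e lt

  ≤⇒≯ : ∀ {x y} → x ≤ y → ¬ y < x
  ≤⇒≯ (*≤* le) (*<* lt) = ℕ.≤⇒≯ le lt

  ≮⇒≥ : ∀ {x y} → ¬ x < y → y ≤ x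
  ≮⇒≥ x≮y = *≤* (ℕ.≮⇒≥ (x≮y ∘ *<*))

  ≰⇒> : ∀ {x y} → ¬ x ≤ y → y < x
  ≰⇒> x≰y = *<* (ℕ.≰⇒> (x≰y ∘ *≤*))

  ≤-antisym : ∀ {x y} → x ≤ y → y ≤ x → x ≈ y
  ≤-antisym (*≤* le₁) (*≤* le₂) = *≡* (ℕ.≤-antisym le₁ le₂)

  <-cmp : Trichotomous _≈_ _<_
  <-cmp x y with ℕ.<-cmp (num x * den y) (num y * den x)
  ... | tri< a ¬b ¬c = tri< (*<* a) (¬b ∘ _≈_.cross) (¬c ∘ _<_.cross)
  ... | tri≈ ¬a b ¬c = tri≈ (¬a ∘ _<_.cross) (*≡* b) (¬c ∘ _<_.cross)
  ... | tri> ¬a ¬b c = tri> (¬a ∘ _<_.cross) (¬b ∘ _≈_.cross) (*<* c)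

  ≤-trans : ∀ {x y z} → x ≤ y → y ≤ z → x ≤ z
  ≤-trans {x} {y} {z} (*≤* le₁) (*≤* le₂) = *≤* (ℕ.*-cancelʳ-≤ _ _ (den y) {{den-nonZero y}} (begin
    num x * den z * den y   ≡⟨ swap₂₃ (num x) (den z) (den y) ⟩
    num x * den y * den z   ≤⟨ ℕ.*-monoˡ-≤ (den z) le₁ ⟩
    num y * den x * den z   ≡⟨ swap₁₂ (num y) (den x) (den z) ⟩
    den x * (num y * den z) ≤⟨ ℕ.*-monoʳ-≤ (den x) le₂ ⟩
    den x * (num z * den y) ≡⟨ swap₁₂ (num z) (den x) (den y) ⟨
    num z * den x * den y   ∎))
    where open ℕ.≤-Reasoning

  <-≤-trans : ∀ {x y z} → x < y → y ≤ z → x < z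
  <-≤-trans {x} {y} {z} (*<* lt) (*≤* le) = *<* (ℕ.*-cancelʳ-< (den y) _ _ (begin-strict
    num x * den z * den y   ≡⟨ swap₂₃ (num x) (den z) (den y) ⟩
    num x * den y * den z   <⟨ ℕ.*-monoˡ-< (den z) {{den-nonZero z}} lt ⟩
    num y * den x * den z   ≡⟨ swap₁₂ (num y) (den x) (den z) ⟩
    den x * (num y * den z) ≤⟨ ℕ.*-monoʳ-≤ (den x) le ⟩
    den x * (num z * den y) ≡⟨ swap₁₂ (num z) (den x) (den y) ⟨
    num z * den x * den y   ∎))
    where open ℕ.≤-Reasoning

  ≤-<-trans : ∀ {x y z} → x ≤ y → y < z → x < z
  ≤-<-trans {x} {y} {z} (*≤* le) (*<* lt) = *<* (ℕ.*-cancelʳ-< (den y) _ _ (begin-strict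
    num x * den z * den y   ≡⟨ swap₂₃ (num x) (den z) (den y) ⟩
    num x * den y * den z   ≤⟨ ℕ.*-monoˡ-≤ (den z) le ⟩
    num y * den x * den z   ≡⟨ swap₁₂ (num y) (den x) (den z) ⟩
    den x * (num y * den z) <⟨ ℕ.*-monoʳ-< (den x) {{den-nonZero x}} lt ⟩
    den x * (num z * den y) ≡⟨ swap₁₂ (num z) (den x) (den y) ⟨
    num z * den x * den y   ∎))
    where open ℕ.≤-Reasoning

  <-trans : ∀ {x y z} → x < y → y < z → x < z
  <-trans x<y = <-≤-trans x<y ∘ <⇒≤

  <-asym : ∀ {x y} → x < y → ¬ y < x
  <-asym x<y = <-irrefl ≈-refl ∘ <-trans x<y

  <-respʳ-≈ : ∀ {x y z} → y ≈ z → x < y → x < z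
  <-respʳ-≈ y≈z x<y = <-≤-trans x<y (≤-reflexive y≈z)

  <-respˡ-≈ : ∀ {x y z} → y ≈ z → y < x → z < x
  <-respˡ-≈ y≈z y<x = ≤-<-trans (≤-reflexive (≈-sym y≈z)) y<x

  ≤-isPreorder : IsPreorder _≈_ _≤_
  ≤-isPreorder = record
    { isEquivalence = ≈-isEquivalence ; reflexive = ≤-reflexive ; trans = ≤-trans }

  module ≤-Reasoning where
    open import Relation.Binary.Reasoning.Base.Triple
      ≤-isPreorder <-asym <-trans (<-respʳ-≈ , <-respˡ-≈) <⇒≤ <-≤-trans ≤-<-trans
      public

  ·-cong : ∀ {x x′ y y′} → x ≈ x′ → y ≈ y′ → x · y ≈ x′ · y′
  ·-cong {a / b} {a′ / b′} {c / d} {c′ / d′} (*≡* e₁) (*≡* e₂) = *≡* (begin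
    a * c * (b′ * d′) ≡⟨ interchange a c b′ d′ ⟩
    a * b′ * (c * d′) ≡⟨ cong₂ _*_ e₁ e₂ ⟩
    a′ * b * (c′ * d) ≡⟨ interchange a′ b c′ d ⟩
    a′ * c′ * (b * d) ∎)
    where open ≡-Reasoning

  ·-congˡ : ∀ x {y z} → y ≈ z → x · y ≈ x · z
  ·-congˡ x = ·-cong (≈-refl {x})

  ·-congʳ : ∀ x {y z} → y ≈ z → y · x ≈ z · x
  ·-congʳ x y≈z = ·-cong y≈z (≈-refl {x})

  ·-comm : ∀ x y → x · y ≈ y · x
  ·-comm (a / b) (c / d) = *≡* (cong₂ _*_ (ℕ.*-comm a c) (ℕ.*-comm d b))

  ·-interchange : ∀ x y z w → (x · y) · (z · w) ≈ (x · z) · (y · w)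
  ·-interchange (a / b) (c / d) (e / f) (g / h) =
    *≡* (cong₂ _*_ (interchange a c e g) (interchange b f d h))

  ·-monoˡ-< : ∀ {x y} z → x < y → x · z < y · z
  ·-monoˡ-< {a / b} {c / d} (e / f) (*<* lt) = *<* (begin-strict
    a * e * (d * f) ≡⟨ interchange a e d f ⟩
    a * d * (e * f) <⟨ ℕ.*-monoˡ-< (e * f) {{ℕ.m*n≢0 e f}} lt ⟩
    c * b * (e * f) ≡⟨ interchange c e b f ⟨
    c * e * (b * f) ∎)
    where open ℕ.≤-Reasoning

  ·-monoˡ-≤ : ∀ {x y} z → x ≤ y → x · z ≤ y · z
  ·-monoˡ-≤ {a / b} {c / d} (e / f) (*≤* le) = *≤* (begin
    a * e * (d * f) ≡⟨ interchange a e d f ⟩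
    a * d * (e * f) ≤⟨ ℕ.*-monoˡ-≤ (e * f) le ⟩
    c * b * (e * f) ≡⟨ interchange c e b f ⟨
    c * e * (b * f) ∎)
    where open ℕ.≤-Reasoning

  ·-monoʳ-< : ∀ {x y} z → x < y → z · x < z · y
  ·-monoʳ-< {x} {y} z x<y =
    <-respʳ-≈ (·-comm y z) (<-respˡ-≈ (·-comm x z) (·-monoˡ-< z x<y))

  ·-monoʳ-≤ : ∀ {x y} z → x ≤ y → z · x ≤ z · y
  ·-monoʳ-≤ {x} {y} z x≤y = begin
    z · x ≈⟨ ·-comm z x ⟩
    x · z ≤⟨ ·-monoˡ-≤ z x≤y ⟩
    y · z ≈⟨ ·-comm y z ⟩
    z · y ∎
    where open ≤-Reasoning

  ·-mono-≤ : ∀ {x x′ y y′} → x ≤ x′ → y ≤ y′ → x · y ≤ x′ · y′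
  ·-mono-≤ {x′ = x′} {y} x≤x′ y≤y′ = ≤-trans (·-monoˡ-≤ y x≤x′) (·-monoʳ-≤ x′ y≤y′)

  ·-mono-<-≤ : ∀ {x x′ y y′} → x < x′ → y ≤ y′ → x · y < x′ · y′
  ·-mono-<-≤ {x′ = x′} {y} x<x′ y≤y′ = <-≤-trans (·-monoˡ-< y x<x′) (·-monoʳ-≤ x′ y≤y′)

  ·-mono-≤-< : ∀ {x x′ y y′} → x ≤ x′ → y < y′ → x · y < x′ · y′
  ·-mono-≤-< {x′ = x′} {y} x≤x′ y<y′ = ≤-<-trans (·-monoˡ-≤ y x≤x′) (·-monoʳ-< x′ y<y′)

  ⁻¹-cong : ∀ {x y} → x ≈ y → x ⁻¹ ≈ y ⁻¹
  ⁻¹-cong {a / b} {c / d} (*≡* e) = *≡* (trans (ℕ.*-comm b c) (trans (sym e) (ℕ.*-comm a d)))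

  ·-inverseʳ : ∀ x → x · x ⁻¹ ≈ 1ℚ⁺
  ·-inverseʳ (a / b) = *≡* (trans (ℕ.*-identityʳ (a * b)) (trans (ℕ.*-comm a b) (sym (ℕ.*-identityˡ (b * a)))))

  ⁻¹-distrib-· : ∀ x y → (x · y) ⁻¹ ≈ x ⁻¹ · y ⁻¹
  ⁻¹-distrib-· (a / b) (c / d) = ≈-refl

  fromℕ-* : ∀ m n → .{{NonZero m}} → .{{NonZero n}} → fromℕ (m * n) ≈ fromℕ m · fromℕ n
  fromℕ-* (suc m) (suc n) = ≈-refl

  ⁻¹-involutive : ∀ x → x ⁻¹ ⁻¹ ≈ x
  ⁻¹-involutive (a / b) = ≈-refl

  ⁻¹-anti-mono-< : ∀ {x y} → x < y → y ⁻¹ < x ⁻¹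
  ⁻¹-anti-mono-< {a / b} {c / d} (*<* lt) = *<* (subst₂ ℕ._<_ (ℕ.*-comm a d) (ℕ.*-comm c b) lt)

  ⁻¹-anti-mono-≤ : ∀ {x y} → x ≤ y → y ⁻¹ ≤ x ⁻¹
  ⁻¹-anti-mono-≤ {a / b} {c / d} (*≤* le) = *≤* (subst₂ ℕ._≤_ (ℕ.*-comm a d) (ℕ.*-comm c b) le)

  private
    rearrangeˡ : ∀ a d f g → a * d * (f * g) ≡ a * f * (d * g)
    rearrangeˡ = solve-∀

    rearrangeʳ : ∀ e h b c → e * h * (b * c) ≡ c * h * (b * e)
    rearrangeʳ = solve-∀

  ·⁻¹-<-swap : ∀ x y z w → x · y ⁻¹ < z · w ⁻¹ → x · z ⁻¹ < y · w ⁻¹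
  ·⁻¹-<-swap (a / b) (c / d) (e / f) (g / h) (*<* lt) =
    *<* (subst₂ ℕ._<_ (rearrangeˡ a d f g) (rearrangeʳ e h b c) lt)

  ·⁻¹-≤-swap : ∀ x y z w → x · y ⁻¹ ≤ z · w ⁻¹ → x · z ⁻¹ ≤ y · w ⁻¹
  ·⁻¹-≤-swap (a / b) (c / d) (e / f) (g / h) (*≤* le) =
    *≤* (subst₂ ℕ._≤_ (rearrangeˡ a d f g) (rearrangeʳ e h b c) le)

  ·⁻¹-≈-swap : ∀ x y z w → x · y ⁻¹ ≈ z · w ⁻¹ → x · z ⁻¹ ≈ y · w ⁻¹
  ·⁻¹-≈-swap (a / b) (c / d) (e / f) (g / h) (*≡* eq) =
    *≡* (subst₂ _≡_ (rearrangeˡ a d f g) (rearrangeʳ e h b c) eq)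

  private
    ^-distribʳ-* : ∀ a b k → (a * b) ℕ.^ k ≡ a ℕ.^ k * b ℕ.^ k
    ^-distribʳ-* a b zero    = refl
    ^-distribʳ-* a b (suc k) = begin
      a * b * (a * b) ℕ.^ k         ≡⟨ cong (a * b *_) (^-distribʳ-* a b k) ⟩
      a * b * (a ℕ.^ k * b ℕ.^ k)   ≡⟨ interchange a b (a ℕ.^ k) (b ℕ.^ k) ⟩
      a * a ℕ.^ k * (b * b ℕ.^ k)   ∎
      where open ≡-Reasoning

    posPart-negPart : ∀ r → + posPart r ≡ r ℤ.+ + negPart r
    posPart-negPart (+ n)    = sym (ℤ.+-identityʳ (+ n))
    posPart-negPart -[1+ n ] = sym (ℤ.n⊖n≡0 (suc n))

    posPart-negPart-+ : ∀ r s → posPart (r ℤ.+ s) ℕ.+ negPart r ℕ.+ negPart s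
                              ≡ negPart (r ℤ.+ s) ℕ.+ posPart r ℕ.+ posPart s
    posPart-negPart-+ r s = ℤ.+-injective (begin
      + P[r+s] ℤ.+ + N[r] ℤ.+ + N[s]
        ≡⟨ cong (λ t → t ℤ.+ + N[r] ℤ.+ + N[s]) (posPart-negPart (r ℤ.+ s)) ⟩
      r ℤ.+ s ℤ.+ + N[r+s] ℤ.+ + N[r] ℤ.+ + N[s]
        ≡⟨ regroup r s (+ N[r+s]) (+ N[r]) (+ N[s]) ⟩
      + N[r+s] ℤ.+ (r ℤ.+ + N[r]) ℤ.+ (s ℤ.+ + N[s])
        ≡⟨ cong₂ (λ u v → + N[r+s] ℤ.+ u ℤ.+ v) (posPart-negPart r) (posPart-negPart s) ⟨
      + N[r+s] ℤ.+ + posPart r ℤ.+ + posPart s ∎)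
      where
      open ≡-Reasoning
      P[r+s] = posPart (r ℤ.+ s)
      N[r+s] = negPart (r ℤ.+ s)
      N[r] = negPart r
      N[s] = negPart s
      regroup : ∀ r s a b c → r ℤ.+ s ℤ.+ a ℤ.+ b ℤ.+ c ≡ a ℤ.+ (r ℤ.+ b) ℤ.+ (s ℤ.+ c)
      regroup = ℤ-Solver.solve-∀

  posPart-neg : ∀ r → posPart (ℤ.- r) ≡ negPart r
  posPart-neg (+ zero)  = refl
  posPart-neg (+ suc n) = refl
  posPart-neg -[1+ n ]  = refl

  negPart-neg : ∀ r → negPart (ℤ.- r) ≡ posPart r
  negPart-neg (+ zero)  = refl
  negPart-neg (+ suc n) = refl
  negPart-neg -[1+ n ]  = refl

  ^-cong : ∀ r {x y} → x ≈ y → x ^ r ≈ y ^ r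
  ^-cong r {a / b} {c / d} (*≡* e) = *≡* (begin
    a ℕ.^ P * b ℕ.^ N * (d ℕ.^ P * c ℕ.^ N)
      ≡⟨ interchange (a ℕ.^ P) (b ℕ.^ N) (d ℕ.^ P) (c ℕ.^ N) ⟩
    a ℕ.^ P * d ℕ.^ P * (b ℕ.^ N * c ℕ.^ N)
      ≡⟨ cong₂ _*_ (^-distribʳ-* a d P) (^-distribʳ-* b c N) ⟨
    (a * d) ℕ.^ P * (b * c) ℕ.^ N
      ≡⟨ cong₂ (λ u v → u ℕ.^ P * v ℕ.^ N) e (trans (ℕ.*-comm b c) (trans (sym e) (ℕ.*-comm a d))) ⟩
    (c * b) ℕ.^ P * (d * a) ℕ.^ N
      ≡⟨ cong₂ _*_ (^-distribʳ-* c b P) (^-distribʳ-* d a N) ⟩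
    c ℕ.^ P * b ℕ.^ P * (d ℕ.^ N * a ℕ.^ N)
      ≡⟨ interchange (c ℕ.^ P) (b ℕ.^ P) (d ℕ.^ N) (a ℕ.^ N) ⟩
    c ℕ.^ P * d ℕ.^ N * (b ℕ.^ P * a ℕ.^ N) ∎)
    where
    open ≡-Reasoning
    P = posPart r
    N = negPart r

  ^-⁻¹ : ∀ r x → (x ⁻¹) ^ r ≈ (x ^ r) ⁻¹
  ^-⁻¹ r (a / b) = ≈-refl

  ^-distrib-· : ∀ r x y → (x · y) ^ r ≈ x ^ r · y ^ r
  ^-distrib-· r (a / b) (c / d) = *≡* (cong₂ _*_
    (trans (cong₂ _*_ (^-distribʳ-* a c P) (^-distribʳ-* b d N)) (interchange (a ℕ.^ P) (c ℕ.^ P) (b ℕ.^ N) (d ℕ.^ N)))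
    (sym (trans (cong₂ _*_ (^-distribʳ-* b d P) (^-distribʳ-* a c N)) (interchange (b ℕ.^ P) (d ℕ.^ P) (a ℕ.^ N) (c ℕ.^ N)))))
    where
    P = posPart r
    N = negPart r

  ^-distribˡ-+ : ∀ r s x → x ^ (r ℤ.+ s) ≈ x ^ r · x ^ s
  ^-distribˡ-+ r s (a / b) = *≡* (begin
    a ℕ.^ P * b ℕ.^ N * (b ℕ.^ Pr * a ℕ.^ Nr * (b ℕ.^ Ps * a ℕ.^ Ns))
      ≡⟨ regroupˡ (a ℕ.^ P) (b ℕ.^ N) (b ℕ.^ Pr) (a ℕ.^ Nr) (b ℕ.^ Ps) (a ℕ.^ Ns) ⟩
    a ℕ.^ P * a ℕ.^ Nr * a ℕ.^ Ns * (b ℕ.^ N * b ℕ.^ Pr * b ℕ.^ Ps)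
      ≡⟨ cong₂ _*_ (^-+₃ a P Nr Ns) (^-+₃ b N Pr Ps) ⟩
    a ℕ.^ (P ℕ.+ Nr ℕ.+ Ns) * b ℕ.^ (N ℕ.+ Pr ℕ.+ Ps)
      ≡⟨ cong₂ (λ i j → a ℕ.^ i * b ℕ.^ j) (posPart-negPart-+ r s) (sym (posPart-negPart-+ r s)) ⟩
    a ℕ.^ (N ℕ.+ Pr ℕ.+ Ps) * b ℕ.^ (P ℕ.+ Nr ℕ.+ Ns)
      ≡⟨ cong₂ _*_ (^-+₃ a N Pr Ps) (^-+₃ b P Nr Ns) ⟨
    a ℕ.^ N * a ℕ.^ Pr * a ℕ.^ Ps * (b ℕ.^ P * b ℕ.^ Nr * b ℕ.^ Ns)
      ≡⟨ regroupʳ (a ℕ.^ N) (a ℕ.^ Pr) (a ℕ.^ Ps) (b ℕ.^ P) (b ℕ.^ Nr) (b ℕ.^ Ns) ⟩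
    a ℕ.^ Pr * b ℕ.^ Nr * (a ℕ.^ Ps * b ℕ.^ Ns) * (b ℕ.^ P * a ℕ.^ N) ∎)
    where
    open ≡-Reasoning
    P = posPart (r ℤ.+ s)
    N = negPart (r ℤ.+ s)
    Pr = posPart r
    Nr = negPart r
    Ps = posPart s
    Ns = negPart s
    ^-+₃ : ∀ a i j k → a ℕ.^ i * a ℕ.^ j * a ℕ.^ k ≡ a ℕ.^ (i ℕ.+ j ℕ.+ k)
    ^-+₃ a i j k = sym (trans (ℕ.^-distribˡ-+-* a (i ℕ.+ j) k)
                              (cong (_* a ℕ.^ k) (ℕ.^-distribˡ-+-* a i j)))
    regroupˡ : ∀ u v w y z t → u * v * (w * y * (z * t)) ≡ u * y * t * (v * w * z)
    regroupˡ = solve-∀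
    regroupʳ : ∀ u v w y z t → u * v * w * (y * z * t) ≡ v * z * (w * t) * (y * u)
    regroupʳ = solve-∀

  ^-neg : ∀ r x → x ^ (ℤ.- r) ≈ (x ^ r) ⁻¹
  ^-neg r (a / b) = *≡* (cong₂ _*_
    (trans (cong₂ (λ i j → a ℕ.^ i * b ℕ.^ j) (posPart-neg r) (negPart-neg r))
           (ℕ.*-comm (a ℕ.^ negPart r) (b ℕ.^ posPart r)))
    (sym (trans (cong₂ (λ i j → b ℕ.^ i * a ℕ.^ j) (posPart-neg r) (negPart-neg r))
                (ℕ.*-comm (b ℕ.^ negPart r) (a ℕ.^ posPart r)))))

  ^-zeroʳ : ∀ x → x ^ + 0 ≈ 1ℚ⁺
  ^-zeroʳ (a / b) = ≈-refl

  ^-identityʳ : ∀ x → x ^ + 1 ≈ x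
  ^-identityʳ (a / b) = *≡* (identity a b)
    where
    identity : ∀ a b → a * 1 * 1 * b ≡ a * (b * 1 * 1)
    identity = solve-∀

  ^-zeroˡ : ∀ r → 1ℚ⁺ ^ r ≈ 1ℚ⁺
  ^-zeroˡ r = *≡* (cong₂ _*_ (cong₂ _*_ (ℕ.^-zeroˡ (posPart r)) (ℕ.^-zeroˡ (negPart r)))
                              (sym (cong₂ _*_ (ℕ.^-zeroˡ (posPart r)) (ℕ.^-zeroˡ (negPart r)))))

  private
    ^-^-comm⁺ : ∀ r n x → (x ^ r) ^ + n ≈ (x ^ + n) ^ r
    ^-^-comm⁺ r zero x = begin-equality
      (x ^ r) ^ + 0 ≈⟨ ^-zeroʳ (x ^ r) ⟩
      1ℚ⁺           ≈⟨ ^-zeroˡ r ⟨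
      1ℚ⁺ ^ r       ≈⟨ ^-cong r (^-zeroʳ x) ⟨
      (x ^ + 0) ^ r ∎
      where open ≤-Reasoning
    ^-^-comm⁺ r (suc n) x = begin-equality
      (x ^ r) ^ (+ 1 ℤ.+ + n)           ≈⟨ ^-distribˡ-+ (+ 1) (+ n) (x ^ r) ⟩
      (x ^ r) ^ + 1 · (x ^ r) ^ + n     ≈⟨ ·-cong (^-identityʳ (x ^ r)) (^-^-comm⁺ r n x) ⟩
      x ^ r · (x ^ + n) ^ r             ≈⟨ ·-congʳ ((x ^ + n) ^ r) (^-cong r (^-identityʳ x)) ⟨
      (x ^ + 1) ^ r · (x ^ + n) ^ r     ≈⟨ ^-distrib-· r (x ^ + 1) (x ^ + n) ⟨
      (x ^ + 1 · x ^ + n) ^ r           ≈⟨ ^-cong r (^-distribˡ-+ (+ 1) (+ n) x) ⟨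
      (x ^ (+ 1 ℤ.+ + n)) ^ r           ∎
      where open ≤-Reasoning

  ^-^-comm : ∀ r s x → (x ^ r) ^ s ≈ (x ^ s) ^ r
  ^-^-comm r (+ n)    x = ^-^-comm⁺ r n x
  ^-^-comm r -[1+ n ] x = begin-equality
    (x ^ r) ^ ℤ.- + suc n             ≈⟨ ^-neg (+ suc n) (x ^ r) ⟩
    ((x ^ r) ^ + suc n) ⁻¹            ≈⟨ ⁻¹-cong (^-^-comm⁺ r (suc n) x) ⟩
    ((x ^ + suc n) ^ r) ⁻¹            ≈⟨ ^-⁻¹ r (x ^ + suc n) ⟨
    ((x ^ + suc n) ⁻¹) ^ r            ≈⟨ ^-cong r (^-neg (+ suc n) x) ⟨
    (x ^ ℤ.- + suc n) ^ r             ∎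
    where open ≤-Reasoning

  ^-monoˡ-< : ∀ k {x y} → x < y → x ^ + suc k < y ^ + suc k
  ^-monoˡ-< k {a / b} {c / d} (*<* lt) = *<* (begin-strict
    a ℕ.^ m * 1 * (d ℕ.^ m * 1) ≡⟨ drop-ones (a ℕ.^ m) (d ℕ.^ m) ⟩
    a ℕ.^ m * d ℕ.^ m           ≡⟨ ^-distribʳ-* a d m ⟨
    (a * d) ℕ.^ m               <⟨ ℕ.^-monoˡ-< m lt ⟩
    (c * b) ℕ.^ m               ≡⟨ ^-distribʳ-* c b m ⟩
    c ℕ.^ m * b ℕ.^ m           ≡⟨ drop-ones (c ℕ.^ m) (b ℕ.^ m) ⟨
    c ℕ.^ m * 1 * (b ℕ.^ m * 1) ∎)
    where
    open ℕ.≤-Reasoning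
    m = suc k

  ^-monoˡ-≤ : ∀ n {x y} → x ≤ y → x ^ + n ≤ y ^ + n
  ^-monoˡ-≤ n {a / b} {c / d} (*≤* le) = *≤* (begin
    a ℕ.^ n * 1 * (d ℕ.^ n * 1) ≡⟨ drop-ones (a ℕ.^ n) (d ℕ.^ n) ⟩
    a ℕ.^ n * d ℕ.^ n           ≡⟨ ^-distribʳ-* a d n ⟨
    (a * d) ℕ.^ n               ≤⟨ ℕ.^-monoˡ-≤ n le ⟩
    (c * b) ℕ.^ n               ≡⟨ ^-distribʳ-* c b n ⟩
    c ℕ.^ n * b ℕ.^ n           ≡⟨ drop-ones (c ℕ.^ n) (b ℕ.^ n) ⟨
    c ℕ.^ n * 1 * (b ℕ.^ n * 1) ∎)
    where open ℕ.≤-Reasoning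

  ^-cancelˡ-< : ∀ k {x y} → x ^ + suc k < y ^ + suc k → x < y
  ^-cancelˡ-< k xᵏ<yᵏ = ≰⇒> (λ y≤x → ≤⇒≯ (^-monoˡ-≤ (suc k) y≤x) xᵏ<yᵏ)

  ^-cancelˡ-≤ : ∀ k {x y} → x ^ + suc k ≤ y ^ + suc k → x ≤ y
  ^-cancelˡ-≤ k xᵏ≤yᵏ = ≮⇒≥ (λ y<x → ≤⇒≯ xᵏ≤yᵏ (^-monoˡ-< k y<x))

  ^-anti-monoˡ-< : ∀ k {x y} → x < y → y ^ -[1+ k ] < x ^ -[1+ k ]
  ^-anti-monoˡ-< k {x} {y} x<y = begin-strict
    y ^ ℤ.- + suc k  ≈⟨ ^-neg (+ suc k) y ⟩
    (y ^ + suc k) ⁻¹ <⟨ ⁻¹-anti-mono-< (^-monoˡ-< k x<y) ⟩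
    (x ^ + suc k) ⁻¹ ≈⟨ ^-neg (+ suc k) x ⟨
    x ^ ℤ.- + suc k  ∎
    where open ≤-Reasoning

  ^-anti-cancelˡ-< : ∀ k {x y} → x ^ -[1+ k ] < y ^ -[1+ k ] → y < x
  ^-anti-cancelˡ-< k xᵏ<yᵏ = ≰⇒> (λ x≤y → ≤⇒≯ (^-anti-monoˡ-≤ x≤y) xᵏ<yᵏ)
    where
    ^-anti-monoˡ-≤ : ∀ {x y} → x ≤ y → y ^ -[1+ k ] ≤ x ^ -[1+ k ]
    ^-anti-monoˡ-≤ {x} {y} x≤y = begin
      y ^ ℤ.- + suc k  ≈⟨ ^-neg (+ suc k) y ⟩
      (y ^ + suc k) ⁻¹ ≤⟨ ⁻¹-anti-mono-≤ (^-monoˡ-≤ (suc k) x≤y) ⟩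
      (x ^ + suc k) ⁻¹ ≈⟨ ^-neg (+ suc k) x ⟨
      x ^ ℤ.- + suc k  ∎
      where open ≤-Reasoning

  1<^⁺ : ∀ k {x} → 1ℚ⁺ < x → 1ℚ⁺ < x ^ + suc k
  1<^⁺ k {x} 1<x = begin-strict
    1ℚ⁺             ≈⟨ ^-zeroˡ (+ suc k) ⟨
    1ℚ⁺ ^ + suc k   <⟨ ^-monoˡ-< k 1<x ⟩
    x ^ + suc k     ∎
    where open ≤-Reasoning

  1≤^⁺ : ∀ n {x} → 1ℚ⁺ < x → 1ℚ⁺ ≤ x ^ + n
  1≤^⁺ zero    {x} _   = ≤-reflexive (≈-sym (^-zeroʳ x))
  1≤^⁺ (suc n)     1<x = <⇒≤ (1<^⁺ n 1<x)

  ^⁻<1 : ∀ k {x} → 1ℚ⁺ < x → x ^ -[1+ k ] < 1ℚ⁺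
  ^⁻<1 k {x} 1<x = begin-strict
    x ^ ℤ.- + suc k   ≈⟨ ^-neg (+ suc k) x ⟩
    (x ^ + suc k) ⁻¹  <⟨ ⁻¹-anti-mono-< (1<^⁺ k 1<x) ⟩
    1ℚ⁺               ∎
    where open ≤-Reasoning

module Slope where

  open import Data.Integer as ℤ using (ℤ; +_; -[1+_])
  open import Data.Nat using (zero; suc)
  open import Data.Product using (_×_; _,_)
  open import Relation.Nullary using (¬_; contradiction)
  open import Relation.Binary.PropositionalEquality using (_≡_; refl)
  open PositiveRational

  -- (x , r) stands for the vector (log x , r) of the log-plane.
  Vector : Set
  Vector = ℚ⁺ × ℤ

  infixl 6 _⊕_
  infix  4 _≺_ _≼_ _∥_ _≋_

  Rightward : Vector → Set
  Rightward (x , _) = 1ℚ⁺ < x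

  -- u ≺ w says that the cross product w × u is negative; for rightward u
  -- and w it says that u has the smaller slope.
  _≺_ : Vector → Vector → Set
  (x , r) ≺ (y , s) = y ^ r < x ^ s

  _≼_ : Vector → Vector → Set
  (x , r) ≼ (y , s) = y ^ r ≤ x ^ s

  _∥_ : Vector → Vector → Set
  (x , r) ∥ (y , s) = y ^ r ≈ x ^ s

  _⊕_ : Vector → Vector → Vector
  (x , r) ⊕ (y , s) = (x · y , r ℤ.+ s)

  reflect : Vector → Vector
  reflect (x , r) = (x , ℤ.- r)

  ≺⇒⋡ : ∀ u w → u ≺ w → ¬ w ≼ u
  ≺⇒⋡ (x , r) (y , s) = <⇒≱
    where
    <⇒≱ : ∀ {a b} → a < b → ¬ b ≤ a
    <⇒≱ a<b b≤a = ≤⇒≯ b≤a a<b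

  ⋡⇒≺ : ∀ u w → ¬ w ≼ u → u ≺ w
  ⋡⇒≺ (x , r) (y , s) = ≰⇒>

  ⊀⇒≽ : ∀ u w → ¬ u ≺ w → w ≼ u
  ⊀⇒≽ (x , r) (y , s) = ≮⇒≥

  ∥-sym : ∀ u w → u ∥ w → w ∥ u
  ∥-sym (x , r) (y , s) = ≈-sym

  ≼-reflect : ∀ u w → u ≼ w → reflect w ≼ reflect u
  ≼-reflect (x , r) (y , s) yʳ≤xˢ = begin
    x ^ ℤ.- s   ≈⟨ ^-neg s x ⟩
    (x ^ s) ⁻¹  ≤⟨ ⁻¹-anti-mono-≤ yʳ≤xˢ ⟩
    (y ^ r) ⁻¹  ≈⟨ ^-neg r y ⟨
    y ^ ℤ.- r   ∎
    where open ≤-Reasoning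

  reflect-≼ : ∀ u w → reflect u ≼ reflect w → w ≼ u
  reflect-≼ (x , r) (y , s) y⁻ʳ≤x⁻ˢ = begin
    x ^ s                ≈⟨ ⁻¹-involutive (x ^ s) ⟨
    (x ^ s) ⁻¹ ⁻¹        ≈⟨ ⁻¹-cong (^-neg s x) ⟨
    (x ^ ℤ.- s) ⁻¹       ≤⟨ ⁻¹-anti-mono-≤ y⁻ʳ≤x⁻ˢ ⟩
    (y ^ ℤ.- r) ⁻¹       ≈⟨ ⁻¹-cong (^-neg r y) ⟩
    (y ^ r) ⁻¹ ⁻¹        ≈⟨ ⁻¹-involutive (y ^ r) ⟩
    y ^ r                ∎
    where open ≤-Reasoning

  _≋_ : Vector → Vector → Set
  (x , r) ≋ (y , s) = x ≈ y × r ≡ s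

  ≺-respʳ-≋ : ∀ u v w → v ≋ w → u ≺ v → u ≺ w
  ≺-respʳ-≋ (x , r) (y , s) (y′ , .s) (y≈y′ , refl) = <-respˡ-≈ (^-cong r y≈y′)

  private
    ≤1-transfer : ∀ r {x y} → 1ℚ⁺ < x → 1ℚ⁺ < y → x ^ r ≤ 1ℚ⁺ → y ^ r ≤ 1ℚ⁺
    ≤1-transfer (+ zero) {y = y} _ _ _ = ≤-reflexive (^-zeroʳ y)
    ≤1-transfer (+ suc k) 1<x _   x≤1 = contradiction (1<^⁺ k 1<x) (≤⇒≯ x≤1)
    ≤1-transfer -[1+ k ]  _   1<y _   = <⇒≤ (^⁻<1 k 1<y)

    1≤-transfer : ∀ r {x y} → 1ℚ⁺ < x → 1ℚ⁺ < y → 1ℚ⁺ ≤ x ^ r → 1ℚ⁺ ≤ y ^ r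
    1≤-transfer (+ zero) {y = y} _ _ _ = ≤-reflexive (≈-sym (^-zeroʳ y))
    1≤-transfer (+ suc k) _   1<y _   = <⇒≤ (1<^⁺ k 1<y)
    1≤-transfer -[1+ k ]  1<x _   1≤x = contradiction (^⁻<1 k 1<x) (≤⇒≯ 1≤x)

    -- The case of a middle vector of non-negative slope; the other case is
    -- its mirror image.
    ≼-trans⁺ : ∀ x y z r n t → 1ℚ⁺ < x → 1ℚ⁺ < y → 1ℚ⁺ < z →
               (x , r) ≼ (y , + n) → (y , + n) ≼ (z , t) → (x , r) ≼ (z , t)
    ≼-trans⁺ x y z r zero t 1<x 1<y 1<z yʳ≤x⁰ z⁰≤yᵗ = ≤-trans
      (≤1-transfer r 1<y 1<z (≤-trans yʳ≤x⁰ (≤-reflexive (^-zeroʳ x))))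
      (1≤-transfer t 1<y 1<x (≤-trans (≤-reflexive (≈-sym (^-zeroʳ z))) z⁰≤yᵗ))
    ≼-trans⁺ x y z r (suc k) (+ zero) _ _ 1<z _ zˢ≤y⁰ =
      contradiction (<-respʳ-≈ (^-zeroʳ y) (<-≤-trans (1<^⁺ k 1<z) zˢ≤y⁰)) (<-irrefl ≈-refl)
    ≼-trans⁺ x y z r (suc k) -[1+ m ] _ 1<y 1<z _ zˢ≤yᵗ =
      contradiction (<-trans (<-≤-trans (1<^⁺ k 1<z) zˢ≤yᵗ) (^⁻<1 m 1<y)) (<-irrefl ≈-refl)
    ≼-trans⁺ x y z -[1+ j ] (suc k) (+ suc m) 1<x _ 1<z _ _ =
      <⇒≤ (<-trans (^⁻<1 j 1<z) (1<^⁺ m 1<x))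
    ≼-trans⁺ x y z (+ j) (suc k) (+ suc m) _ _ _ yʳ≤xˢ zˢ≤yᵗ = ^-cancelˡ-≤ k (begin
      (z ^ r) ^ s  ≈⟨ ^-^-comm r s z ⟩
      (z ^ s) ^ r  ≤⟨ ^-monoˡ-≤ j zˢ≤yᵗ ⟩
      (y ^ t) ^ r  ≈⟨ ^-^-comm t r y ⟩
      (y ^ r) ^ t  ≤⟨ ^-monoˡ-≤ (suc m) yʳ≤xˢ ⟩
      (x ^ s) ^ t  ≈⟨ ^-^-comm s t x ⟩
      (x ^ t) ^ s  ∎)
      where
      open ≤-Reasoning
      r = + j
      s = + suc k
      t = + suc m

  ≼-trans : ∀ u v w → Rightward u → Rightward v → Rightward w → u ≼ v → v ≼ w → u ≼ w
  ≼-trans (x , r) (y , + n) (z , t) = ≼-trans⁺ x y z r n t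
  ≼-trans u@(x , r) v@(y , -[1+ n ]) w@(z , t) →u →v →w u≼v v≼w = reflect-≼ w u
    (≼-trans⁺ z y x (ℤ.- t) (suc n) (ℤ.- r) →w →v →u (≼-reflect v w v≼w) (≼-reflect u v u≼v))

  ≼-≺-trans : ∀ u v w → Rightward u → Rightward v → Rightward w → u ≼ v → v ≺ w → u ≺ w
  ≼-≺-trans u v w →u →v →w u≼v v≺w =
    ⋡⇒≺ u w (λ w≼u → ≺⇒⋡ v w v≺w (≼-trans w u v →w →u →v w≼u u≼v))

  ≺-≼-trans : ∀ u v w → Rightward u → Rightward v → Rightward w → u ≺ v → v ≼ w → u ≺ w
  ≺-≼-trans u v w →u →v →w u≺v v≼w =
    ⋡⇒≺ u w (λ w≼u → ≺⇒⋡ u v u≺v (≼-trans v w u →v →w →u v≼w w≼u))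

  ≺⇒≺⊕ : ∀ u w → u ≺ w → u ≺ u ⊕ w
  ≺⇒≺⊕ (x , r) (y , s) yʳ<xˢ = begin-strict
    (x · y) ^ r    ≈⟨ ^-distrib-· r x y ⟩
    x ^ r · y ^ r  <⟨ ·-monoʳ-< (x ^ r) yʳ<xˢ ⟩
    x ^ r · x ^ s  ≈⟨ ^-distribˡ-+ r s x ⟨
    x ^ (r ℤ.+ s)  ∎
    where open ≤-Reasoning

  data SameSign : ℤ → ℤ → Set where
    positive : ∀ {k m} → SameSign (+ suc k) (+ suc m)
    zero     : SameSign (+ 0) (+ 0)
    negative : ∀ {k m} → SameSign -[1+ k ] -[1+ m ]

  private
    1<-≈-≯ : ∀ {a b} → 1ℚ⁺ < a → a ≈ b → ¬ b < 1ℚ⁺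
    1<-≈-≯ 1<a a≈b b<1 = <-asym 1<a (<-respˡ-≈ (≈-sym a≈b) b<1)

    1<-≉1 : ∀ {a b} → 1ℚ⁺ < a → a ≈ b → ¬ b ≈ 1ℚ⁺
    1<-≉1 1<a a≈b b≈1 = <-irrefl ≈-refl (<-respʳ-≈ (≈-trans a≈b b≈1) 1<a)

    ^-≈-sameSign : ∀ r s {x y} → 1ℚ⁺ < x → 1ℚ⁺ < y → x ^ r ≈ y ^ s → SameSign r s
    ^-≈-sameSign (+ suc k) (+ suc m) _ _ _ = positive
    ^-≈-sameSign (+ zero)  (+ zero)  _ _ _ = zero
    ^-≈-sameSign -[1+ k ]  -[1+ m ]  _ _ _ = negative
    ^-≈-sameSign (+ suc k) (+ zero) {y = y} 1<x _ e =
      contradiction (^-zeroʳ y) (1<-≉1 (1<^⁺ k 1<x) e)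
    ^-≈-sameSign (+ suc k) -[1+ m ] 1<x 1<y e = contradiction (^⁻<1 m 1<y) (1<-≈-≯ (1<^⁺ k 1<x) e)
    ^-≈-sameSign (+ zero) (+ suc m) {x} 1<x 1<y e =
      contradiction (^-zeroʳ x) (1<-≉1 (1<^⁺ m 1<y) (≈-sym e))
    ^-≈-sameSign (+ zero) -[1+ m ] {x} _ 1<y e =
      contradiction (<-respˡ-≈ (≈-sym e) (^⁻<1 m 1<y)) (<-irrefl (≈-sym (^-zeroʳ x)))
    ^-≈-sameSign -[1+ k ] (+ suc m) 1<x 1<y e = contradiction (^⁻<1 k 1<x) (1<-≈-≯ (1<^⁺ m 1<y) (≈-sym e))
    ^-≈-sameSign -[1+ k ] (+ zero) {y = y} 1<x _ e =
      contradiction (<-respˡ-≈ e (^⁻<1 k 1<x)) (<-irrefl (≈-sym (^-zeroʳ y)))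

    <1-transfer : ∀ r {x y} → 1ℚ⁺ < x → 1ℚ⁺ < y → x ^ r < 1ℚ⁺ → y ^ r < 1ℚ⁺
    <1-transfer (+ zero) {x} _ _ x⁰<1 = contradiction x⁰<1 (<-irrefl (^-zeroʳ x))
    <1-transfer (+ suc k) 1<x _ xʳ<1 = contradiction xʳ<1 (<-asym (1<^⁺ k 1<x))
    <1-transfer -[1+ k ] _ 1<y _ = ^⁻<1 k 1<y

  ≺-respʳ-∥ : ∀ u v w → Rightward v → Rightward w → v ∥ w → u ≺ v → u ≺ w
  ≺-respʳ-∥ (x , a) (L , r) (L′ , r′) 1<L 1<L′ L′ʳ≈Lʳ′ Lᵃ<xʳ
    with ^-≈-sameSign r′ r 1<L 1<L′ (≈-sym L′ʳ≈Lʳ′)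
  ... | positive {k} {m} = ^-cancelˡ-< m (begin-strict
    (L′ ^ a) ^ r    ≈⟨ ^-^-comm a r L′ ⟩
    (L′ ^ r) ^ a    ≈⟨ ^-cong a L′ʳ≈Lʳ′ ⟩
    (L ^ r′) ^ a    ≈⟨ ^-^-comm r′ a L ⟩
    (L ^ a) ^ r′    <⟨ ^-monoˡ-< k Lᵃ<xʳ ⟩
    (x ^ r) ^ r′    ≈⟨ ^-^-comm r r′ x ⟩
    (x ^ r′) ^ r    ∎)
    where open ≤-Reasoning
  ... | zero = <-respʳ-≈ (≈-sym (^-zeroʳ x))
    (<1-transfer a 1<L 1<L′ (<-respʳ-≈ (^-zeroʳ x) Lᵃ<xʳ))
  ... | negative {k} {m} = ^-anti-cancelˡ-< m (begin-strict
    (x ^ r′) ^ r    ≈⟨ ^-^-comm r′ r x ⟩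
    (x ^ r) ^ r′    <⟨ ^-anti-monoˡ-< k Lᵃ<xʳ ⟩
    (L ^ a) ^ r′    ≈⟨ ^-^-comm a r′ L ⟩
    (L ^ r′) ^ a    ≈⟨ ^-cong a L′ʳ≈Lʳ′ ⟨
    (L′ ^ r) ^ a    ≈⟨ ^-^-comm r a L′ ⟩
    (L′ ^ a) ^ r    ∎)
    where open ≤-Reasoning

module LogPlane where

  open import Data.Integer as ℤ using (ℤ; +_)
  import Data.Integer.Properties as ℤ
  import Data.Integer.Tactic.RingSolver as ℤ-Solver
  open import Data.Nat as ℕ using (ℕ; suc; NonZero; _*_)
  import Data.Nat.Properties as ℕ
  open import Data.Product using (_×_; _,_; proj₁)
  open import Function using (_∘_)
  open import Data.Nat.Tactic.RingSolver using (solve-∀)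
  open import Relation.Nullary using (yes; no; contradiction)
  open import Relation.Binary.PropositionalEquality using (_≡_; sym; trans; cong; cong₂; subst₂)
  open import Data.List using (List; []; _∷_)
  open PositiveRational
  open Slope

  vec : Pt → Pt → Vector
  vec A B = (fromℕ (idx B) · fromℕ (idx A) ⁻¹ , val B ℤ.- val A)

  direction : Edge → Vector
  direction (A , B) = vec A B

  -- The linear form v log(b/a) - r log i on the log-plane, for D = (A , B)
  -- and C = (i , v), exponentiated; it is constant on the lines parallel to D.
  height : Edge → Pt → ℚ⁺
  height D C = proj₁ (direction D) ^ val C · (fromℕ (idx C) ^ rise D) ⁻¹

  module _ (D : Edge) (C C′ : Pt) where
    private
      L = proj₁ (direction D)
      r = rise D
      x = fromℕ (idx C)
      x′ = fromℕ (idx C′)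

      vertical : L ^ val C · (L ^ val C′) ⁻¹ ≈ L ^ (val C ℤ.- val C′)
      vertical = ≈-sym (≈-trans (^-distribˡ-+ (val C) (ℤ.- val C′) L)
                                (·-congˡ (L ^ val C) (^-neg (val C′) L)))

      horizontal : x ^ r · (x′ ^ r) ⁻¹ ≈ (x · x′ ⁻¹) ^ r
      horizontal = ≈-sym (≈-trans (^-distrib-· r x (x′ ⁻¹)) (·-congˡ (x ^ r) (^-⁻¹ r x′)))

      a = L ^ val C
      b = x ^ r
      a′ = L ^ val C′
      b′ = x′ ^ r

    height-<⇒≺ : height D C < height D C′ → vec C′ C ≺ direction D
    height-<⇒≺ = <-respʳ-≈ horizontal ∘ <-respˡ-≈ vertical ∘ ·⁻¹-<-swap a b a′ b′

    ≺⇒height-< : vec C′ C ≺ direction D → height D C < height D C′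
    ≺⇒height-< = ·⁻¹-<-swap a a′ b b′ ∘ <-respʳ-≈ (≈-sym horizontal) ∘ <-respˡ-≈ (≈-sym vertical)

    height-≤⇒≼ : height D C ≤ height D C′ → vec C′ C ≼ direction D
    height-≤⇒≼ h≤ = begin
      L ^ (val C ℤ.- val C′)        ≈⟨ vertical ⟨
      L ^ val C · (L ^ val C′) ⁻¹   ≤⟨ ·⁻¹-≤-swap a b a′ b′ h≤ ⟩
      x ^ r · (x′ ^ r) ⁻¹           ≈⟨ horizontal ⟩
      (x · x′ ⁻¹) ^ r               ∎
      where open ≤-Reasoning

    ≼⇒height-≤ : vec C′ C ≼ direction D → height D C ≤ height D C′
    ≼⇒height-≤ ≼D = ·⁻¹-≤-swap a a′ b b′ (begin
      L ^ val C · (L ^ val C′) ⁻¹   ≈⟨ vertical ⟩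
      L ^ (val C ℤ.- val C′)        ≤⟨ ≼D ⟩
      (x · x′ ⁻¹) ^ r               ≈⟨ horizontal ⟨
      x ^ r · (x′ ^ r) ⁻¹           ∎)
      where open ≤-Reasoning

    height-≈⇒∥ : height D C ≈ height D C′ → vec C′ C ∥ direction D
    height-≈⇒∥ h≈ = ≈-trans (≈-sym vertical) (≈-trans (·⁻¹-≈-swap a b a′ b′ h≈) horizontal)

    ∥⇒height-≈ : vec C′ C ∥ direction D → height D C ≈ height D C′
    ∥⇒height-≈ ∥D = ·⁻¹-≈-swap a a′ b b′ (≈-trans vertical (≈-trans ∥D (≈-sym horizontal)))

  height-<⇒≻ : ∀ D C C′ → height D C < height D C′ → direction D ≺ vec C C′
  height-<⇒≻ D C C′ h< = ⋡⇒≺ (direction D) (vec C C′) (λ ≼D → ≤⇒≯ (≼⇒height-≤ D C′ C ≼D) h<)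

  height-≤⇒≽ : ∀ D C C′ → height D C ≤ height D C′ → direction D ≼ vec C C′
  height-≤⇒≽ D C C′ h≤ = ⊀⇒≽ (vec C C′) (direction D) (λ ≺D → ≤⇒≯ h≤ (≺⇒height-< D C′ C ≺D))

  height-<-resp-∥ : ∀ D D′ C C′ → Rightward (direction D) → Rightward (direction D′) →
                    direction D ∥ direction D′ → height D C < height D C′ → height D′ C < height D′ C′
  height-<-resp-∥ D D′ C C′ →D →D′ D∥D′ =
    ≺⇒height-< D′ C C′ ∘ ≺-respʳ-∥ (vec C′ C) (direction D) (direction D′) →D →D′ D∥D′ ∘ height-<⇒≺ D C C′

  vec-⊕ : ∀ A B C → vec A B ⊕ vec B C ≋ vec A C
  vec-⊕ (a , u) (b , v) (c , w) =
    ≈-trans (·-interchange (fromℕ b) (fromℕ a ⁻¹) (fromℕ c) (fromℕ b ⁻¹)) (cancel (fromℕ a) (fromℕ b) (fromℕ c)) ,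
    telescope (+ u) (+ v) (+ w)
    where
    cancel : ∀ x y z → y · z · (x ⁻¹ · y ⁻¹) ≈ z · x ⁻¹
    cancel (a / b) (c / d) (e / f) = *≡* (rearrange a b c d e f)
      where
      rearrange : ∀ a b c d e f → c * e * (b * d) * (f * a) ≡ e * b * (d * f * (a * c))
      rearrange = solve-∀
    telescope : ∀ u v w → v ℤ.- u ℤ.+ (w ℤ.- v) ≡ w ℤ.- u
    telescope = ℤ-Solver.solve-∀

  convex-corner-≤< : ∀ D C₁ C₂ C₃ → Rightward (direction D) → Rightward (vec C₁ C₂) → Rightward (vec C₂ C₃) →
                     height D C₂ ≤ height D C₁ → height D C₂ < height D C₃ → vec C₁ C₂ ≺ vec C₂ C₃
  convex-corner-≤< D C₁ C₂ C₃ →D →u →w h₂≤h₁ h₂<h₃ =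
    ≼-≺-trans (vec C₁ C₂) (direction D) (vec C₂ C₃) →u →D →w
      (height-≤⇒≼ D C₂ C₁ h₂≤h₁) (height-<⇒≻ D C₂ C₃ h₂<h₃)

  convex-corner-<≤ : ∀ D C₁ C₂ C₃ → Rightward (direction D) → Rightward (vec C₁ C₂) → Rightward (vec C₂ C₃) →
                     height D C₂ < height D C₁ → height D C₂ ≤ height D C₃ → vec C₁ C₂ ≺ vec C₂ C₃
  convex-corner-<≤ D C₁ C₂ C₃ →D →u →w h₂<h₁ h₂≤h₃ =
    ≺-≼-trans (vec C₁ C₂) (direction D) (vec C₂ C₃) →u →D →w
      (height-<⇒≺ D C₂ C₁ h₂<h₁) (height-≤⇒≽ D C₂ C₃ h₂≤h₃)

  corner-below-chord : ∀ C₁ C₂ C₃ → vec C₁ C₂ ≺ vec C₂ C₃ → height (C₁ , C₃) C₂ < height (C₁ , C₃) C₁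
  corner-below-chord C₁ C₂ C₃ =
    ≺⇒height-< (C₁ , C₃) C₂ C₁
    ∘ ≺-respʳ-≋ (vec C₁ C₂) (vec C₁ C₂ ⊕ vec C₂ C₃) (vec C₁ C₃) (vec-⊕ C₁ C₂ C₃)
    ∘ ≺⇒≺⊕ (vec C₁ C₂) (vec C₂ C₃)

  height-on-line : ∀ A B → height (A , B) B ≈ height (A , B) A
  height-on-line A B = ∥⇒height-≈ (A , B) B A ≈-refl

  vec-rightward : ∀ A B → .{{NonZero (idx A)}} → idx A ℕ.< idx B → Rightward (vec A B)
  vec-rightward (suc a , _) (suc b , _) (ℕ.s≤s a≤b) =
    *<* (subst₂ ℕ._<_ (unitˡ a) (unitʳ b) (ℕ.s≤s a≤b))
    where
    unitˡ : ∀ a → suc a ≡ 1 * (1 * suc a)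
    unitˡ = solve-∀
    unitʳ : ∀ b → suc b ≡ suc b * 1 * 1
    unitʳ = solve-∀

  private
    powers : ℕ → ℕ → ℤ → List (ℕ × ℤ)
    powers b a x = (b , x) ∷ (a , ℤ.- x) ∷ []

    prodPos-powers : ∀ a b x → .{{NonZero a}} → .{{NonZero b}} →
                     prodPos (powers b a x) ≡ num ((fromℕ b · fromℕ a ⁻¹) ^ x)
    prodPos-powers (suc a) (suc b) x = cong₂ _*_
      (cong (ℕ._^ posPart x) (sym (ℕ.*-identityʳ (suc b))))
      (trans (ℕ.*-identityʳ _) (trans (cong (suc a ℕ.^_) (posPart-neg x))
                                      (cong (ℕ._^ negPart x) (sym (ℕ.*-identityˡ (suc a))))))

    prodNeg-powers : ∀ a b x → .{{NonZero a}} → .{{NonZero b}} →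
                     prodNeg (powers b a x) ≡ den ((fromℕ b · fromℕ a ⁻¹) ^ x)
    prodNeg-powers (suc a) (suc b) x = trans (ℕ.*-comm (suc b ℕ.^ negPart x) _) (cong₂ _*_
      (trans (ℕ.*-identityʳ _) (trans (cong (suc a ℕ.^_) (negPart-neg x))
                                      (cong (ℕ._^ posPart x) (sym (ℕ.*-identityˡ (suc a))))))
      (cong (ℕ._^ negPart x) (sym (ℕ.*-identityʳ (suc b)))))

  module _ (A B C : Pt) .{{_ : NonZero (idx A)}} .{{_ : NonZero (idx B)}} .{{_ : NonZero (idx C)}} where
    private
      x = val C ℤ.- val A
      y = val B ℤ.- val A
      lhs = cong₂ _*_ (prodPos-powers (idx A) (idx B) x) (prodNeg-powers (idx A) (idx C) y)
      rhs = cong₂ _*_ (prodPos-powers (idx A) (idx C) y) (prodNeg-powers (idx A) (idx B) x)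

    StrictlyBelow⇒height-< : StrictlyBelow A B C → height (A , B) C < height (A , B) A
    StrictlyBelow⇒height-< below = ≺⇒height-< (A , B) C A (*<* (subst₂ ℕ._<_ lhs rhs below))

    height-<⇒StrictlyBelow : height (A , B) C < height (A , B) A → StrictlyBelow A B C
    height-<⇒StrictlyBelow h< = subst₂ ℕ._<_ (sym lhs) (sym rhs) (_<_.cross (height-<⇒≺ (A , B) C A h<))

  _⊙_ : Pt → Pt → Pt
  (a , v) ⊙ (b , w) = (a * b , v ℕ.+ w)

  height-⊙ : ∀ D A B → .{{NonZero (idx A)}} → .{{NonZero (idx B)}} →
             height D (A ⊙ B) ≈ height D A · height D B
  height-⊙ D A@(a , v) B@(b , w) = begin-equality
    L ^ (+ v ℤ.+ + w) · (fromℕ (a * b) ^ r) ⁻¹           ≈⟨ ·-cong (^-distribˡ-+ (+ v) (+ w) L) (⁻¹-cong (^-cong r (fromℕ-* a b))) ⟩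
    L ^ + v · L ^ + w · ((fromℕ a · fromℕ b) ^ r) ⁻¹     ≈⟨ ·-congˡ (L ^ + v · L ^ + w) (⁻¹-cong (^-distrib-· r (fromℕ a) (fromℕ b))) ⟩
    L ^ + v · L ^ + w · (fromℕ a ^ r · fromℕ b ^ r) ⁻¹   ≈⟨ ·-congˡ (L ^ + v · L ^ + w) (⁻¹-distrib-· (fromℕ a ^ r) (fromℕ b ^ r)) ⟩
    L ^ + v · L ^ + w · ((fromℕ a ^ r) ⁻¹ · (fromℕ b ^ r) ⁻¹)
      ≈⟨ ·-interchange (L ^ + v) (L ^ + w) ((fromℕ a ^ r) ⁻¹) ((fromℕ b ^ r) ⁻¹) ⟩
    height D A · height D B ∎
    where
    open ≤-Reasoning
    L = proj₁ (direction D)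
    r = rise D

  height-val-< : ∀ D i v w → Rightward (direction D) → height D (i , v) < height D (i , w) → v ℕ.< w
  height-val-< D i v w 1<L h< with w ℕ.≤? v
  ... | no w≰v  = ℕ.≰⇒> w≰v
  ... | yes w≤v = contradiction (≤-<-trans (1≤^⁺ (v ℕ.∸ w) 1<L) (<-respˡ-≈ (^-cong-exponent) below-1)) (<-irrefl ≈-refl)
    where
    L = proj₁ (direction D)
    below-1 : L ^ (+ v ℤ.- + w) < 1ℚ⁺
    below-1 = <-respʳ-≈ (≈-trans (^-cong (rise D) (·-inverseʳ (fromℕ i))) (^-zeroˡ (rise D)))
                        (height-<⇒≺ D (i , v) (i , w) h<)
    ^-cong-exponent : L ^ (+ v ℤ.- + w) ≈ L ^ + (v ℕ.∸ w)
    ^-cong-exponent = ≈-reflexive (cong (L ^_) (trans (ℤ.m-n≡m⊖n v w) (ℤ.⊖-≥ w≤v)))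

  Forward : Edge → Set
  Forward (A , B) = NonZero (idx A) × idx A ℕ.< idx B

  Forward⇒Rightward : ∀ D → Forward D → Rightward (direction D)
  Forward⇒Rightward (A , B) (a≢0 , a<b) = vec-rightward A B {{a≢0}} a<b

  private
    module _ (A₁ B₁ A₂ B₂ : Pt) .{{_ : NonZero (idx A₁)}} .{{_ : NonZero (idx B₁)}}
             .{{_ : NonZero (idx A₂)}} .{{_ : NonZero (idx B₂)}} where
      r₁ = rise (A₁ , B₁)
      r₂ = rise (A₂ , B₂)
      x₁ = proj₁ (vec A₁ B₁)
      x₂ = proj₁ (vec A₂ B₂)

      numerators : prodPos (powers (idx B₂) (idx A₂) r₁) * prodNeg (powers (idx B₁) (idx A₁) r₂)
                 ≡ num (x₂ ^ r₁) * den (x₁ ^ r₂)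
      numerators = cong₂ _*_ (prodPos-powers (idx A₂) (idx B₂) (rise (A₁ , B₁)))
                             (prodNeg-powers (idx A₁) (idx B₁) (rise (A₂ , B₂)))
      denominators : prodPos (powers (idx B₁) (idx A₁) r₂) * prodNeg (powers (idx B₂) (idx A₂) r₁)
                   ≡ num (x₁ ^ r₂) * den (x₂ ^ r₁)
      denominators = cong₂ _*_ (prodPos-powers (idx A₁) (idx B₁) (rise (A₂ , B₂)))
                               (prodNeg-powers (idx A₂) (idx B₂) (rise (A₁ , B₁)))

    Forward⇒NonZero : ∀ {A B} → Forward (A , B) → NonZero (idx B)
    Forward⇒NonZero (a≢0 , a<b) = ℕ.>-nonZero (ℕ.<-≤-trans (ℕ.>-nonZero⁻¹ _ {{a≢0}}) (ℕ.<⇒≤ a<b))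

  SameSlope⇒∥ : ∀ D E → Forward D → Forward E → SameSlope D E → direction D ∥ direction E
  SameSlope⇒∥ (A₁ , B₁) (A₂ , B₂) fw₁@(a₁≢0 , _) fw₂@(a₂≢0 , _) same =
    *≡* (subst₂ _≡_ (numerators A₁ B₁ A₂ B₂) (denominators A₁ B₁ A₂ B₂) same)
    where
    instance
      _ = a₁≢0
      _ = a₂≢0
      b₁≢0 : NonZero (idx B₁)
      b₁≢0 = Forward⇒NonZero {A₁} {B₁} fw₁
      b₂≢0 : NonZero (idx B₂)
      b₂≢0 = Forward⇒NonZero {A₂} {B₂} fw₂

  ∥⇒SameSlope : ∀ D E → Forward D → Forward E → direction D ∥ direction E → SameSlope D E
  ∥⇒SameSlope (A₁ , B₁) (A₂ , B₂) fw₁@(a₁≢0 , _) fw₂@(a₂≢0 , _) (*≡* parallel) =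
    subst₂ _≡_ (sym (numerators A₁ B₁ A₂ B₂)) (sym (denominators A₁ B₁ A₂ B₂)) parallel
    where
    instance
      _ = a₁≢0
      _ = a₂≢0
      b₁≢0 : NonZero (idx B₁)
      b₁≢0 = Forward⇒NonZero {A₁} {B₁} fw₁
      b₂≢0 : NonZero (idx B₂)
      b₂≢0 = Forward⇒NonZero {A₂} {B₂} fw₂

  VecSum-⊙ : ∀ A A′ B B′ → VecSum (A ⊙ A′ , B ⊙ B′) (A , B) (A′ , B′)
  VecSum-⊙ (a , u) (a′ , u′) (b , v) (b′ , v′) =
    ℕ.*-comm (b * b′) (a * a′) , regroup (+ u) (+ u′) (+ v) (+ v′)
    where
    regroup : ∀ u u′ v v′ → v ℤ.+ v′ ℤ.- (u ℤ.+ u′) ≡ v ℤ.- u ℤ.+ (v′ ℤ.- u′)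
    regroup = ℤ-Solver.solve-∀

  VecEq-⊙ʳ : ∀ A B C → VecEq (A ⊙ C , B ⊙ C) (A , B)
  VecEq-⊙ʳ (a , u) (b , v) (c , w) = rearrange b c a , cancel (+ u) (+ v) (+ w)
    where
    rearrange : ∀ b c a → b * c * a ≡ a * c * b
    rearrange = solve-∀
    cancel : ∀ u v w → v ℤ.+ w ℤ.- (u ℤ.+ w) ≡ v ℤ.- u
    cancel = ℤ-Solver.solve-∀

  VecEq-⊙ˡ : ∀ C A B → VecEq (C ⊙ A , C ⊙ B) (A , B)
  VecEq-⊙ˡ (c , w) (a , u) (b , v) = rearrange c b a , cancel (+ u) (+ v) (+ w)
    where
    rearrange : ∀ c b a → c * b * a ≡ c * a * b
    rearrange = solve-∀
    cancel : ∀ u v w → w ℤ.+ v ℤ.- (w ℤ.+ u) ≡ v ℤ.- u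
    cancel = ℤ-Solver.solve-∀

module IndexOrder where

  open import Data.Nat as ℕ using (ℕ; _*_; _<_; _>_; NonZero)
  import Data.Nat.Properties as ℕ
  open import Data.Product using (_×_; _,_)
  open import Data.Sum using (_⊎_; inj₁; inj₂)
  open import Function using (flip)
  open import Relation.Nullary using (¬_; yes; no; contradiction)
  open import Relation.Binary.Definitions using (Trichotomous; Transitive; Decidable; tri<; tri≈; tri>)
  open import Relation.Binary.Consequences using (tri⇒irr; tri⇒dec<)
  open import Relation.Binary.PropositionalEquality using (_≡_; refl; sym)

  *-<-split : ∀ {j k a b} → j * k < a * b → j < a ⊎ k < b
  *-<-split {j} {k} {a} {b} jk<ab with j ℕ.<? a | k ℕ.<? b
  ... | yes j<a | _       = inj₁ j<a
  ... | no  _   | yes k<b = inj₂ k<b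
  ... | no  j≮a | no  k≮b = contradiction jk<ab (ℕ.≤⇒≯ (ℕ.*-mono-≤ (ℕ.≮⇒≥ j≮a) (ℕ.≮⇒≥ k≮b)))

  *-≡-split : ∀ {j k a b} .{{_ : NonZero j}} .{{_ : NonZero b}} →
              j * k ≡ a * b → ¬ (j ≡ a × k ≡ b) → j < a ⊎ k < b
  *-≡-split {j} {k} {a} {b} jk≡ab jk≢ab with ℕ.<-cmp j a | ℕ.<-cmp k b
  ... | tri< j<a _ _    | _               = inj₁ j<a
  ... | tri≈ _ _ _      | tri< k<b _ _    = inj₂ k<b
  ... | tri> _ _ _      | tri< k<b _ _    = inj₂ k<b
  ... | tri≈ _ j≡a _    | tri≈ _ k≡b _    = contradiction (j≡a , k≡b) jk≢ab
  ... | tri≈ _ refl _   | tri> _ _ b<k    = contradiction (sym jk≡ab) (ℕ.<⇒≢ (ℕ.*-monoʳ-< j b<k))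
  ... | tri> _ _ a<j    | tri≈ _ refl _   = contradiction (sym jk≡ab) (ℕ.<⇒≢ (ℕ.*-monoˡ-< k a<j))
  ... | tri> _ _ a<j    | tri> _ _ b<k    =
    contradiction (sym jk≡ab) (ℕ.<⇒≢ (ℕ.<-≤-trans (ℕ.*-monoˡ-< b a<j) (ℕ.*-monoʳ-≤ j (ℕ.<⇒≤ b<k))))

  -- The order in which indices are scanned for the first lowest point of a face:
  -- left to right for its left end, right to left for its right end.
  record IndexOrder : Set₁ where
    infix 4 _⊏_
    field
      _⊏_       : ℕ → ℕ → Set
      compare   : Trichotomous _≡_ _⊏_
      ⊏-trans   : Transitive _⊏_
      *-split-⊏ : ∀ {j k a b} → j * k ⊏ a * b → j ⊏ a ⊎ k ⊏ b
      *-split-≡ : ∀ {j k a b} .{{_ : NonZero j}} .{{_ : NonZero k}} .{{_ : NonZero a}} .{{_ : NonZero b}} →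
                  j * k ≡ a * b → ¬ (j ≡ a × k ≡ b) → j ⊏ a ⊎ k ⊏ b

    ⊏-irrefl : ∀ {i} → ¬ i ⊏ i
    ⊏-irrefl = tri⇒irr compare refl

    _⊏?_ : Decidable _⊏_
    _⊏?_ = tri⇒dec< compare

  leftToRight : IndexOrder
  leftToRight = record
    { _⊏_       = _<_
    ; compare   = ℕ.<-cmp
    ; ⊏-trans   = ℕ.<-trans
    ; *-split-⊏ = *-<-split
    ; *-split-≡ = *-≡-split
    }

  rightToLeft : IndexOrder
  rightToLeft = record
    { _⊏_       = _>_
    ; compare   = >-cmp
    ; ⊏-trans   = flip ℕ.<-trans
    ; *-split-⊏ = *-<-split
    ; *-split-≡ = λ jk≡ab jk≢ab → *-≡-split (sym jk≡ab) λ (a≡j , b≡k) → jk≢ab (sym a≡j , sym b≡k)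
    }
    where
    >-cmp : Trichotomous _≡_ _>_
    >-cmp i j with ℕ.<-cmp i j
    ... | tri< i<j i≢j i≯j = tri> i≯j i≢j i<j
    ... | tri≈ i≮j i≡j i≯j = tri≈ i≯j i≡j i≮j
    ... | tri> i≮j i≢j i>j = tri< i>j i≢j i≮j

module Minimal where

  open import Data.List using (List; []; _∷_)
  open import Data.List.Membership.Propositional using (_∈_)
  open import Data.List.Relation.Unary.Any using (here; there)
  open import Data.Product using (∃-syntax; _×_; _,_)
  open import Relation.Nullary using (¬_; yes; no)
  open import Relation.Binary.Definitions using (Transitive; Decidable)
  open import Relation.Binary.PropositionalEquality using (refl)

  module _ {a r} {A : Set a} {_⋖_ : A → A → Set r}
           (⋖-irrefl : ∀ {x} → ¬ x ⋖ x) (⋖-trans : Transitive _⋖_) (_⋖?_ : Decidable _⋖_) where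

    private
      minimal∷ : ∀ x xs → ∃[ m ] m ∈ x ∷ xs × (∀ {y} → y ∈ x ∷ xs → ¬ y ⋖ m)
      minimal∷ x [] = x , here refl , λ { (here refl) → ⋖-irrefl }
      minimal∷ x (x′ ∷ xs) with minimal∷ x′ xs
      ... | m , m∈ , m-min with x ⋖? m
      ...   | yes x⋖m = x , here refl , λ where
              (here refl)  → ⋖-irrefl
              (there y∈) y⋖x → m-min y∈ (⋖-trans y⋖x x⋖m)
      ...   | no  x⋪m = m , there m∈ , λ where
              (here refl)  → x⋪m
              (there y∈)   → m-min y∈

    minimal : ∀ {x} xs → x ∈ xs → ∃[ m ] m ∈ xs × (∀ {y} → y ∈ xs → ¬ y ⋖ m)
    minimal (x ∷ xs) _ = minimal∷ x xs

module Divisibility {c ℓ} (R : CommutativeRing c ℓ) where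

  open import Data.Product using (_,_)
  open CommutativeRing R
  open Ring R using (_∣_)
  import Algebra.Properties.Ring ring as RingProperties

  ∣0 : ∀ a → a ∣ 0#
  ∣0 a = 0# , sym (zeroʳ a)

  ∣-respʳ : ∀ {d a b} → a ≈ b → d ∣ a → d ∣ b
  ∣-respʳ a≈b (q , a≈dq) = q , trans (sym a≈b) a≈dq

  ∣-trans : ∀ {a b e} → a ∣ b → b ∣ e → a ∣ e
  ∣-trans {a} (q , b≈aq) (q′ , e≈bq′) = q * q′ , trans e≈bq′ (trans (*-cong b≈aq refl) (*-assoc a q q′))

  ∣-+ : ∀ {d a b} → d ∣ a → d ∣ b → d ∣ (a + b)
  ∣-+ {d} (q₁ , a≈dq₁) (q₂ , b≈dq₂) = q₁ + q₂ , trans (+-cong a≈dq₁ b≈dq₂) (sym (distribˡ d q₁ q₂))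

  ∣-difference : ∀ {d a b} → d ∣ a → d ∣ b → d ∣ (a - b)
  ∣-difference {d} d∣a (q , b≈dq) = ∣-+ d∣a (- q , trans (-‿cong b≈dq) (RingProperties.-‿distribʳ-* d q))

module Valuation {c ℓ} (R : CommutativeRing c ℓ) (ufd : Ring.IsUFD R)
                 (p : CommutativeRing.Carrier R) (p-prime : Ring.IsPrime R p) where

  open import Data.Nat as ℕ using (ℕ; zero; suc)
  open import Relation.Binary.Definitions using (tri<; tri≈; tri>)
  import Data.Nat.Properties as ℕ
  open import Data.Product using (∃; ∃-syntax; _×_; _,_; proj₁; proj₂)
  open import Data.Sum using (_⊎_; inj₁; inj₂)
  open import Data.List using (List; []; _∷_; _++_; length; replicate)
  open import Data.List.Properties using (length-++; length-replicate)
  open import Data.List.Relation.Unary.All using (All)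
  open import Data.List.Relation.Unary.All.Properties using (++⁺; replicate⁺)
  open import Data.List.Relation.Binary.Permutation.Propositional.Properties using (↭-length)
  open import Data.List.Relation.Binary.Pointwise.Properties using (Pointwise-length)
  open import Relation.Nullary using (¬_; Dec; contradiction; yes; no)
  open import Relation.Nullary.Decidable using (¬¬-excluded-middle)
  open import Relation.Nullary.Negation using (¬¬-map)
  open import Function using (_∘_)
  open import Relation.Binary.PropositionalEquality as ≡ using (_≡_)

  open CommutativeRing R
  open Ring R
  open IsUFD ufd
  open Divisibility R
  import Algebra.Solver.CommutativeMonoid *-commutativeMonoid as *-Solver
  open import Relation.Binary.Reasoning.Setoid setoid

  private
    p≉0 : ¬ p ≈ 0#
    p≉0 = proj₁ p-prime

    p-nonunit : ¬ IsUnit p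
    p-nonunit = proj₁ (proj₂ p-prime)

    p∣⇒p∣∨p∣ : ∀ a b → p ∣ (a * b) → p ∣ a ⊎ p ∣ b
    p∣⇒p∣∨p∣ = proj₂ (proj₂ p-prime)

    interchange : ∀ a b c d → (a * b) * (c * d) ≈ (a * c) * (b * d)
    interchange = *-Solver.solve 4 (λ a b c d → (a ⊕ b) ⊕ (c ⊕ d) ⊜ (a ⊕ c) ⊕ (b ⊕ d)) refl
      where open *-Solver

    rotate : ∀ x y z → (x * y) * z ≈ y * (x * z)
    rotate = *-Solver.solve 3 (λ x y z → (x ⊕ y) ⊕ z ⊜ y ⊕ (x ⊕ z)) refl
      where open *-Solver

  ^-+ : ∀ m n → p ^ (m ℕ.+ n) ≈ p ^ m * p ^ n
  ^-+ zero    n = sym (*-identityˡ (p ^ n))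
  ^-+ (suc m) n = trans (*-cong refl (^-+ m n)) (sym (*-assoc p (p ^ m) (p ^ n)))

  ^-∣-^ : ∀ {m n} → m ℕ.≤ n → (p ^ m) ∣ (p ^ n)
  ^-∣-^ {m} {n} m≤n = p ^ (n ℕ.∸ m) ,
    trans (reflexive (≡.cong (p ^_) (≡.sym (ℕ.m+[n∸m]≡n m≤n)))) (^-+ m (n ℕ.∸ m))

  ^-∣-* : ∀ {m n a b} → (p ^ m) ∣ a → (p ^ n) ∣ b → (p ^ (m ℕ.+ n)) ∣ (a * b)
  ^-∣-* {m} {n} {a} {b} (q , a≈pᵐq) (q′ , b≈pⁿq′) = q * q′ , (begin
    a * b                       ≈⟨ *-cong a≈pᵐq b≈pⁿq′ ⟩
    (p ^ m * q) * (p ^ n * q′)  ≈⟨ interchange (p ^ m) q (p ^ n) q′ ⟩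
    (p ^ m * p ^ n) * (q * q′)  ≈⟨ *-cong (^-+ m n) refl ⟨
    p ^ (m ℕ.+ n) * (q * q′)    ∎)

  ^≉0 : ∀ n → ¬ p ^ n ≈ 0#
  ^≉0 zero    1≈0 = nontrivial 1≈0
  ^≉0 (suc n) pⁿ⁺¹≈0 with noZeroDivisors p (p ^ n) pⁿ⁺¹≈0
  ... | inj₁ p≈0  = p≉0 p≈0
  ... | inj₂ pⁿ≈0 = ^≉0 n pⁿ≈0

  *-cancelˡ : ∀ {a x y} → ¬ a ≈ 0# → a * x ≈ a * y → x ≈ y
  *-cancelˡ {a} {x} {y} a≉0 ax≈ay with noZeroDivisors a (x - y) (begin
    a * (x - y)         ≈⟨ distribˡ a x (- y) ⟩
    a * x + a * - y     ≈⟨ +-cong ax≈ay refl ⟩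
    a * y + a * - y     ≈⟨ distribˡ a y (- y) ⟨
    a * (y - y)         ≈⟨ *-cong refl (-‿inverseʳ y) ⟩
    a * 0#              ≈⟨ zeroʳ a ⟩
    0#                  ∎)
  ... | inj₁ a≈0   = contradiction a≈0 a≉0
  ... | inj₂ x-y≈0 = begin
    x                ≈⟨ +-identityʳ x ⟨
    x + 0#           ≈⟨ +-cong refl (-‿inverseˡ y) ⟨
    x + (- y + y)    ≈⟨ +-assoc x (- y) y ⟨
    (x - y) + y      ≈⟨ +-cong x-y≈0 refl ⟩
    0# + y           ≈⟨ +-identityˡ y ⟩
    y                ∎

  Val⇒≉0 : ∀ {a k} → Val p a k → ¬ a ≈ 0#
  Val⇒≉0 (_ , p^k+1∤a) a≈0 = p^k+1∤a (∣-respʳ (sym a≈0) (∣0 _))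

  Val-unique : ∀ {a k k′} → Val p a k → Val p a k′ → k ≡ k′
  Val-unique {k = k} {k′} (pᵏ∣a , pᵏ⁺¹∤a) (pᵏ′∣a , pᵏ′⁺¹∤a) with ℕ.<-cmp k k′
  ... | tri< k<k′ _ _ = contradiction (∣-trans (^-∣-^ k<k′) pᵏ′∣a) pᵏ⁺¹∤a
  ... | tri≈ _ k≡k′ _ = k≡k′
  ... | tri> _ _ k′<k = contradiction (∣-trans (^-∣-^ k′<k) pᵏ∣a) pᵏ′⁺¹∤a

  private
    absorb : ∀ {i a q} → a ≈ p ^ i * q → p ∣ q → (p ^ suc i) ∣ a
    absorb {i} {a} {q} a≈pⁱq (t , q≈pt) = t , (begin
      a                ≈⟨ a≈pⁱq ⟩
      p ^ i * q        ≈⟨ *-cong refl q≈pt ⟩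
      p ^ i * (p * t)  ≈⟨ rotate p (p ^ i) t ⟨
      (p * p ^ i) * t  ∎)

  -- The primality of p enters here.
  Val-*-¬∣ : ∀ {a b i j} → Val p a i → Val p b j → ¬ (p ^ suc (i ℕ.+ j)) ∣ (a * b)
  Val-*-¬∣ {a} {b} {i} {j} ((q₁ , a≈pⁱq₁) , pⁱ⁺¹∤a) ((q₂ , b≈pʲq₂) , pʲ⁺¹∤b) (s , ab≈pⁱ⁺ʲ⁺¹s)
    with p∣⇒p∣∨p∣ q₁ q₂ (s , *-cancelˡ (^≉0 (i ℕ.+ j)) (begin
      p ^ (i ℕ.+ j) * (q₁ * q₂)    ≈⟨ *-cong (^-+ i j) refl ⟩
      (p ^ i * p ^ j) * (q₁ * q₂)  ≈⟨ interchange (p ^ i) (p ^ j) q₁ q₂ ⟩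
      (p ^ i * q₁) * (p ^ j * q₂)  ≈⟨ *-cong a≈pⁱq₁ b≈pʲq₂ ⟨
      a * b                        ≈⟨ ab≈pⁱ⁺ʲ⁺¹s ⟩
      (p * p ^ (i ℕ.+ j)) * s      ≈⟨ rotate p (p ^ (i ℕ.+ j)) s ⟩
      p ^ (i ℕ.+ j) * (p * s)      ∎))
  ... | inj₁ p∣q₁ = pⁱ⁺¹∤a (absorb {i} a≈pⁱq₁ p∣q₁)
  ... | inj₂ p∣q₂ = pʲ⁺¹∤b (absorb {j} b≈pʲq₂ p∣q₂)

  Val-*-+ : ∀ {a b i j x r} → Val p a i → Val p b j → x ≈ a * b + r →
            (p ^ suc (i ℕ.+ j)) ∣ r → Val p x (i ℕ.+ j)
  Val-*-+ {a} {b} {i} {j} {x} {r} νa@(pⁱ∣a , _) νb@(pʲ∣b , _) x≈ab+r pⁱ⁺ʲ⁺¹∣r =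
    ∣-respʳ (sym x≈ab+r) (∣-+ (^-∣-* {i} {j} pⁱ∣a pʲ∣b) (∣-trans (^-∣-^ (ℕ.n≤1+n (i ℕ.+ j))) pⁱ⁺ʲ⁺¹∣r)) ,
    λ pⁱ⁺ʲ⁺¹∣x → Val-*-¬∣ {i = i} {j} νa νb (∣-respʳ x-r≈ab (∣-difference pⁱ⁺ʲ⁺¹∣x pⁱ⁺ʲ⁺¹∣r))
    where
    x-r≈ab : x - r ≈ a * b
    x-r≈ab = begin
      x - r                ≈⟨ +-cong x≈ab+r refl ⟩
      (a * b + r) - r      ≈⟨ +-assoc (a * b) r (- r) ⟩
      a * b + (r - r)      ≈⟨ +-cong refl (-‿inverseʳ r) ⟩
      a * b + 0#           ≈⟨ +-identityʳ (a * b) ⟩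
      a * b                ∎

  private
    prod-++ : ∀ xs ys → prod (xs ++ ys) ≈ prod xs * prod ys
    prod-++ []       ys = sym (*-identityˡ (prod ys))
    prod-++ (x ∷ xs) ys = trans (*-cong refl (prod-++ xs ys)) (sym (*-assoc x (prod xs) (prod ys)))

    prod-replicate : ∀ n → prod (replicate n p) ≈ p ^ n
    prod-replicate zero    = refl
    prod-replicate (suc n) = *-cong refl (prod-replicate n)

    p-irreducible : Irreducible p
    p-irreducible = p≉0 , p-nonunit , factors
      where
      unit-cofactor : ∀ a b → p ≈ a * b → p ∣ a → IsUnit b
      unit-cofactor a b p≈ab (t , a≈pt) = t , sym (*-cancelˡ p≉0 (begin
        p * 1#        ≈⟨ *-identityʳ p ⟩
        p             ≈⟨ p≈ab ⟩
        a * b         ≈⟨ *-cong a≈pt refl ⟩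
        (p * t) * b   ≈⟨ *-assoc p t b ⟩
        p * (t * b)   ≈⟨ *-cong refl (*-comm t b) ⟩
        p * (b * t)   ∎))
      factors : ∀ a b → p ≈ a * b → IsUnit a ⊎ IsUnit b
      factors a b p≈ab with p∣⇒p∣∨p∣ a b (1# , trans (sym p≈ab) (sym (*-identityʳ p)))
      ... | inj₁ p∣a = inj₂ (unit-cofactor a b p≈ab p∣a)
      ... | inj₂ p∣b = inj₁ (unit-cofactor b a (trans p≈ab (*-comm a b)) p∣b)

    -- Otherwise p^n (p q) would be a factorisation into more than n irreducibles.
    ¬^∣-prod : ∀ a xs → ¬ a ≈ 0# → All Irreducible xs → a ≈ prod xs → ¬ (p ^ suc (length xs)) ∣ a
    ¬^∣-prod a xs a≉0 irr a≈∏xs (q , a≈pⁿ⁺¹q) = too-long (factorization (p * q) pq≉0 pq-nonunit)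
      where
      n = length xs
      a≈pⁿpq : a ≈ p ^ n * (p * q)
      a≈pⁿpq = trans a≈pⁿ⁺¹q (rotate p (p ^ n) q)
      pq≉0 : ¬ p * q ≈ 0#
      pq≉0 pq≈0 = a≉0 (trans a≈pⁿpq (trans (*-cong refl pq≈0) (zeroʳ (p ^ n))))
      pq-nonunit : ¬ IsUnit (p * q)
      pq-nonunit (u , pqu≈1) = p-nonunit (q * u , trans (sym (*-assoc p q u)) pqu≈1)

      too-long : ¬ (∃[ zs ] (All Irreducible zs × p * q ≈ prod zs))
      too-long ([] , _ , pq≈1) = p-nonunit (q , pq≈1)
      too-long (zs@(_ ∷ _) , irr-zs , pq≈∏zs) = ℕ.m+1+n≢m n (≡.sym n≡n+|zs|)
        where
        factorisation = uniqueness xs (replicate n p ++ zs) irr (++⁺ (replicate⁺ n p-irreducible) irr-zs) (begin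
          prod xs                          ≈⟨ a≈∏xs ⟨
          a                                ≈⟨ a≈pⁿpq ⟩
          p ^ n * (p * q)                  ≈⟨ *-cong (prod-replicate n) (sym pq≈∏zs) ⟨
          prod (replicate n p) * prod zs   ≈⟨ prod-++ (replicate n p) zs ⟨
          prod (replicate n p ++ zs)       ∎)
        ws = proj₁ factorisation
        ws↭ = proj₁ (proj₂ factorisation)
        xs∼ws = proj₂ (proj₂ factorisation)
        n≡n+|zs| : n ≡ n ℕ.+ length zs
        n≡n+|zs| = ≡.trans (Pointwise-length xs∼ws) (≡.trans (↭-length ws↭)
          (≡.trans (length-++ (replicate n p)) (≡.cong (ℕ._+ length zs) (length-replicate n))))

    ¬¬bounded : ∀ a → ¬ a ≈ 0# → ¬ ¬ (∃[ n ] ¬ (p ^ n) ∣ a)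
    ¬¬bounded a a≉0 = ¬¬-map bound ¬¬-excluded-middle
      where
      bound : Dec (IsUnit a) → ∃[ n ] ¬ (p ^ n) ∣ a
      bound (yes (b , ab≈1)) = 1 , λ (q , a≈p1q) → p-nonunit (q * b , (begin
        p * (q * b)          ≈⟨ *-assoc p q b ⟨
        (p * q) * b          ≈⟨ *-cong (*-cong (*-identityʳ p) refl) refl ⟨
        ((p * 1#) * q) * b   ≈⟨ *-cong a≈p1q refl ⟨
        a * b                ≈⟨ ab≈1 ⟩
        1#                   ∎))
      bound (no a-nonunit) with factorization a a≉0 a-nonunit
      ... | xs , irr , a≈∏xs = suc (length xs) , ¬^∣-prod a xs a≉0 irr a≈∏xs

    ¬¬search : ∀ a n j → (p ^ j) ∣ a → ¬ (p ^ (j ℕ.+ n)) ∣ a → ¬ ¬ ∃ (Val p a)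
    ¬¬search a zero    j pʲ∣a pʲ∤a = contradiction (≡.subst (λ k → (p ^ k) ∣ a) (≡.sym (ℕ.+-identityʳ j)) pʲ∣a) pʲ∤a
    ¬¬search a (suc n) j pʲ∣a pʲ⁺ⁿ⁺¹∤a ¬val = ¬¬-excluded-middle λ where
      (yes pʲ⁺¹∣a) → ¬¬search a n (suc j) pʲ⁺¹∣a (pʲ⁺ⁿ⁺¹∤a ∘ ≡.subst (λ k → (p ^ k) ∣ a) (≡.sym (ℕ.+-suc j n))) ¬val
      (no pʲ⁺¹∤a)  → ¬val (j , pʲ∣a , pʲ⁺¹∤a)

  -- Constructively, divisibility by powers of p cannot be decided, so the
  -- valuation is only shown to exist in the double-negation sense.
  ¬¬Val : ∀ a → ¬ a ≈ 0# → ¬ ¬ ∃ (Val p a)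
  ¬¬Val a a≉0 ¬val = ¬¬bounded a a≉0 λ (n , pⁿ∤a) →
    ¬¬search a n 0 (a , sym (*-identityˡ a)) pⁿ∤a ¬val

module DirichletProduct {c ℓ} (R : CommutativeRing c ℓ) where

  open import Data.Bool using (if_then_else_; true; false; T)
  open import Data.Nat as ℕ using (ℕ; zero; suc; z≤n; s≤s; NonZero)
  import Data.Nat.Properties as ℕ
  open import Data.Product using (∃-syntax; _×_; _,_; proj₁; proj₂)
  open import Data.List using (List; []; _∷_; length; applyUpTo)
  open import Data.List.Properties using (length-applyUpTo)
  open import Function using (_∘_)
  open import Data.Empty using (⊥-elim)
  open import Relation.Nullary using (¬_; does; yes; no; contradiction)
  open import Relation.Binary.PropositionalEquality as ≡ using (_≡_; _≢_)
  open CommutativeRing R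
  open Ring R
  open Divisibility R
  open import Relation.Binary.Reasoning.Setoid setoid

  private
    lookup0-beyond : ∀ xs k → length xs ℕ.≤ k → lookup0 xs k ≡ 0#
    lookup0-beyond []       k       _         = ≡.refl
    lookup0-beyond (x ∷ xs) (suc k) (s≤s len≤k) = lookup0-beyond xs k len≤k

    lookup0-applyUpTo : ∀ (f : ℕ → Carrier) n k → k ℕ.< n → lookup0 (applyUpTo f n) k ≡ f k
    lookup0-applyUpTo f (suc n) zero    _         = ≡.refl
    lookup0-applyUpTo f (suc n) (suc k) (s≤s k<n) = lookup0-applyUpTo (f ∘ suc) n k k<n

  coeff-beyond : ∀ F i → length F ℕ.< i → coeff F i ≡ 0#
  coeff-beyond F (suc i) (s≤s len≤i) = lookup0-beyond F i len≤i

  Supp⇒NonZero : ∀ F i → Supp F i → NonZero i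
  Supp⇒NonZero F zero    Fᵢ≉0 = contradiction refl Fᵢ≉0
  Supp⇒NonZero F (suc i) _    = _

  Supp⇒≤length : ∀ F i → Supp F i → i ℕ.≤ length F
  Supp⇒≤length F i Fᵢ≉0 with i ℕ.≤? length F
  ... | yes i≤len = i≤len
  ... | no  i≰len = contradiction (reflexive (coeff-beyond F i (ℕ.≰⇒> i≰len))) Fᵢ≉0

  private
    sum-∣ : ∀ {d} (F : ℕ → Carrier) n → (∀ j → j ℕ.< n → d ∣ F j) → d ∣ sumR (applyUpTo F n)
    sum-∣ F zero    _   = ∣0 _
    sum-∣ F (suc n) d∣F = ∣-+ (d∣F 0 (s≤s z≤n)) (sum-∣ (F ∘ suc) n (λ j j<n → d∣F (suc j) (s≤s j<n)))

    sum-single : ∀ {d} (F : ℕ → Carrier) n j₀ → j₀ ℕ.< n → (∀ j → j ℕ.< n → j ≢ j₀ → d ∣ F j) →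
                 ∃[ r ] sumR (applyUpTo F n) ≈ F j₀ + r × d ∣ r
    sum-single F (suc n) zero _ d∣F =
      sumR (applyUpTo (F ∘ suc) n) , refl , sum-∣ (F ∘ suc) n (λ j j<n → d∣F (suc j) (s≤s j<n) λ ())
    sum-single F (suc n) (suc j₀) (s≤s j₀<n) d∣F
      with sum-single (F ∘ suc) n j₀ j₀<n (λ j j<n j≢j₀ → d∣F (suc j) (s≤s j<n) (j≢j₀ ∘ ℕ.suc-injective))
    ... | r , Σ≈F+r , d∣r = F 0 + r , (begin
      F 0 + sumR (applyUpTo (F ∘ suc) n)  ≈⟨ +-cong refl Σ≈F+r ⟩
      F 0 + (F (suc j₀) + r)              ≈⟨ +-assoc (F 0) (F (suc j₀)) r ⟨
      (F 0 + F (suc j₀)) + r              ≈⟨ +-cong (+-comm (F 0) (F (suc j₀))) refl ⟩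
      (F (suc j₀) + F 0) + r              ≈⟨ +-assoc (F (suc j₀)) (F 0) r ⟩
      F (suc j₀) + (F 0 + r)              ∎) , ∣-+ (d∣F 0 (s≤s z≤n) λ ()) d∣r

    term : DirPoly → DirPoly → ℕ → ℕ → ℕ → Carrier
    term g h i j′ k′ = if does (suc j′ ℕ.* suc k′ ℕ.≟ i) then coeff g (suc j′) * coeff h (suc k′) else 0#

    term-∣ : ∀ {d} g h i j′ k′ → (suc j′ ℕ.* suc k′ ≡ i → d ∣ (coeff g (suc j′) * coeff h (suc k′))) →
             d ∣ term g h i j′ k′
    term-∣ g h i j′ k′ d∣gh with suc j′ ℕ.* suc k′ ℕ.≡ᵇ i in eq
    ... | true  = d∣gh (ℕ.≡ᵇ⇒≡ _ i (≡.subst T (≡.sym eq) _))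
    ... | false = ∣0 _

    term-≡ : ∀ g h i j′ k′ → suc j′ ℕ.* suc k′ ≡ i → term g h i j′ k′ ≡ coeff g (suc j′) * coeff h (suc k′)
    term-≡ g h i j′ k′ jk≡i with suc j′ ℕ.* suc k′ ℕ.≡ᵇ i in eq
    ... | true  = ≡.refl
    ... | false = ⊥-elim (≡.subst T eq (ℕ.≡⇒≡ᵇ _ i jk≡i))

    row : DirPoly → DirPoly → ℕ → ℕ → Carrier
    row g h i j′ = sumR (applyUpTo (term g h i j′) i)

  private
    coeff-⊛-dcoeff : ∀ g h i → i ℕ.< length g ℕ.* length h → coeff (g ⊛ h) (suc i) ≡ dcoeff g h (suc i)
    coeff-⊛-dcoeff g h i i<len = lookup0-applyUpTo (λ i′ → dcoeff g h (suc i′)) (length g ℕ.* length h) i i<len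

    coeff-⊛-beyond : ∀ g h i → length g ℕ.* length h ℕ.≤ i → coeff (g ⊛ h) (suc i) ≡ 0#
    coeff-⊛-beyond g h i len≤i = lookup0-beyond (g ⊛ h) i
      (≡.subst (ℕ._≤ i) (≡.sym (length-applyUpTo (λ i′ → dcoeff g h (suc i′)) (length g ℕ.* length h))) len≤i)

  coeff-⊛-∣ : ∀ {d} g h i → (∀ j k → j ℕ.* k ≡ i → d ∣ (coeff g j * coeff h k)) → d ∣ coeff (g ⊛ h) i
  coeff-⊛-∣ g h zero    _     = ∣0 _
  coeff-⊛-∣ g h (suc i) d∣ghᵢ with suc i ℕ.≤? length g ℕ.* length h
  ... | no  i≮len = ∣-respʳ (reflexive (≡.sym (coeff-⊛-beyond g h i (ℕ.≮⇒≥ i≮len)))) (∣0 _)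
  ... | yes i<len = ∣-respʳ (reflexive (≡.sym (coeff-⊛-dcoeff g h i i<len)))
    (sum-∣ (row g h (suc i)) (suc i) λ j′ _ →
      sum-∣ (term g h (suc i) j′) (suc i) λ k′ _ → term-∣ g h (suc i) j′ k′ (d∣ghᵢ (suc j′) (suc k′)))

  coeff-⊛-split : ∀ {d} g h j k → .{{NonZero j}} → .{{NonZero k}} → j ℕ.* k ℕ.≤ length g ℕ.* length h →
                  (∀ j′ k′ → j′ ℕ.* k′ ≡ j ℕ.* k → ¬ (j′ ≡ j × k′ ≡ k) → d ∣ (coeff g j′ * coeff h k′)) →
                  ∃[ r ] coeff (g ⊛ h) (j ℕ.* k) ≈ coeff g j * coeff h k + r × d ∣ r
  coeff-⊛-split {d} g h j@(suc j₀) k@(suc k₀) jk≤len d∣others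
    with sum-single (row g h i) i j₀ j₀<i (λ j′ _ j′≢j₀ → sum-∣ (term g h i j′) i λ k′ _ →
           term-∣ g h i j′ k′ λ jk≡i → d∣others (suc j′) (suc k′) jk≡i (j′≢j₀ ∘ ℕ.suc-injective ∘ proj₁))
       | sum-single (term g h i j₀) i k₀ k₀<i (λ k′ _ k′≢k₀ →
           term-∣ g h i j₀ k′ λ jk≡i → d∣others j (suc k′) jk≡i (k′≢k₀ ∘ ℕ.suc-injective ∘ proj₂))
    where
    i = j ℕ.* k
    j₀<i = ℕ.<-≤-trans (ℕ.n<1+n j₀) (ℕ.m≤m*n j k)
    k₀<i = ℕ.<-≤-trans (ℕ.n<1+n k₀) (ℕ.m≤n*m k j)
  ... | r₂ , Σ≈row+r₂ , d∣r₂ | r₁ , row≈term+r₁ , d∣r₁ = r₁ + r₂ , (begin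
    coeff (g ⊛ h) (j ℕ.* k)              ≡⟨ coeff-⊛-dcoeff g h _ jk≤len ⟩
    dcoeff g h (j ℕ.* k)                 ≈⟨ Σ≈row+r₂ ⟩
    row g h (j ℕ.* k) j₀ + r₂            ≈⟨ +-cong row≈term+r₁ refl ⟩
    (term g h (j ℕ.* k) j₀ k₀ + r₁) + r₂ ≡⟨ ≡.cong (λ t → (t + r₁) + r₂) (term-≡ g h (j ℕ.* k) j₀ k₀ ≡.refl) ⟩
    (coeff g j * coeff h k + r₁) + r₂    ≈⟨ +-assoc _ r₁ r₂ ⟩
    coeff g j * coeff h k + (r₁ + r₂)    ∎) , ∣-+ d∣r₁ d∣r₂

module NewtonPolygon {c ℓ} (R : CommutativeRing c ℓ) (ufd : Ring.IsUFD R)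
                     (p : CommutativeRing.Carrier R) (p-prime : Ring.IsPrime R p) (F : Ring.DirPoly R) where

  open import Level using (_⊔_)
  open import Data.Nat as ℕ using (ℕ; zero; suc; NonZero)
  import Data.Nat.Properties as ℕ
  open import Data.Product using (∃; _×_; _,_; proj₁; proj₂)
  open import Data.Sum using (_⊎_; inj₁; inj₂; [_,_]′)
  open import Data.List using (List; []; _∷_; length)
  open import Data.List.Membership.Propositional using (_∈_)
  open import Data.List.Relation.Unary.Any using (here; there)
  open import Function using (_∘_)
  open import Relation.Nullary using (¬_; Dec; yes; no; contradiction)
  open import Relation.Nullary.Decidable using (¬¬-excluded-middle)
  open import Relation.Binary.Definitions using (tri<; tri≈; tri>)
  open import Relation.Binary.PropositionalEquality as ≡ using (_≡_)

  open CommutativeRing R using (Carrier; 0#; _≈_)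
  open Ring R using (coeff; Supp; Val)
  open Ring.Newton R p F public
  open Valuation R ufd p p-prime using (Val-unique; Val⇒≉0; ¬¬Val)
  open DirichletProduct R using (Supp⇒NonZero; Supp⇒≤length; coeff-beyond)
  open module ℚ⁺ = PositiveRational using (ℚ⁺; _<_; _≤_)
  open Slope
  open LogPlane
  open IndexOrder
  open Minimal

  IsPoint⇒NonZero : ∀ C → IsPoint C → NonZero (idx C)
  IsPoint⇒NonZero C (Fᵢ≉0 , _) = Supp⇒NonZero F (idx C) Fᵢ≉0

  IsPoint-unique : ∀ C C′ → IsPoint C → IsPoint C′ → idx C ≡ idx C′ → C ≡ C′
  IsPoint-unique (i , v) (.i , v′) (_ , νᵢ) (_ , ν′ᵢ) ≡.refl = ≡.cong (i ,_) (Val-unique νᵢ ν′ᵢ)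

  private
    fwd : ∀ A B → IsPoint A → idx A ℕ.< idx B → Forward (A , B)
    fwd A B pA a<b = IsPoint⇒NonZero A pA , a<b

    →vec : ∀ A B → IsPoint A → idx A ℕ.< idx B → Rightward (vec A B)
    →vec A B pA a<b = Forward⇒Rightward (A , B) (fwd A B pA a<b)

  Lowest : Edge → Pt → Set (c ⊔ ℓ)
  Lowest D A = ∀ C → IsPoint C → ¬ height D C < height D A

  record End (O : IndexOrder) (D : Edge) (A : Pt) : Set (c ⊔ ℓ) where
    field
      isPoint : IsPoint A
      lowest  : Lowest D A
      first   : ∀ C → IsPoint C → IndexOrder._⊏_ O (idx C) (idx A) → height D A < height D C

  LeftEnd RightEnd : Edge → Pt → Set (c ⊔ ℓ)
  LeftEnd  = End leftToRight
  RightEnd = End rightToLeft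

  End-≈ : ∀ {O O′ D A B} → End O D A → End O′ D B → height D A ℚ⁺.≈ height D B
  End-≈ {A = A} {B} endA endB = ℚ⁺.≤-antisym
    (ℚ⁺.≮⇒≥ (End.lowest endA B (End.isPoint endB))) (ℚ⁺.≮⇒≥ (End.lowest endB A (End.isPoint endA)))

  End-unique : ∀ {O D A A′} → End O D A → End O D A′ → A ≡ A′
  End-unique {O} {D} {A} {A′} endA endA′ with IndexOrder.compare O (idx A) (idx A′)
  ... | tri< A⊏A′ _ _ = contradiction (End.first endA′ A (End.isPoint endA) A⊏A′) (End.lowest endA A′ (End.isPoint endA′))
  ... | tri≈ _ a≡a′ _ = IsPoint-unique A A′ (End.isPoint endA) (End.isPoint endA′) a≡a′
  ... | tri> _ _ A′⊏A = contradiction (End.first endA A′ (End.isPoint endA′) A′⊏A) (End.lowest endA′ A (End.isPoint endA))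

  LeftEnd≤RightEnd : ∀ {D A B} → LeftEnd D A → RightEnd D B → idx A ℕ.≤ idx B
  LeftEnd≤RightEnd {A = A} {B} leftA rightB =
    ℕ.≮⇒≥ λ b<a → End.lowest leftA B (End.isPoint rightB) (End.first rightB A (End.isPoint leftA) b<a)

  End-resp-∥ : ∀ {O D D′ A} → Forward D → Forward D′ → direction D ∥ direction D′ → End O D A → End O D′ A
  End-resp-∥ {D = D} {D′} {A} fwD fwD′ D∥D′ endA = record
    { isPoint = End.isPoint endA
    ; lowest  = λ C pC → End.lowest endA C pC ∘ height-<-resp-∥ D′ D C A →D′ →D (∥-sym (direction D) (direction D′) D∥D′)
    ; first   = λ C pC C⊏A → height-<-resp-∥ D D′ A C →D →D′ D∥D′ (End.first endA C pC C⊏A)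
    }
    where
    →D = Forward⇒Rightward D fwD
    →D′ = Forward⇒Rightward D′ fwD′

  IsEdge : Edge → Set (c ⊔ ℓ)
  IsEdge E@(A , B) = idx A ℕ.< idx B × LeftEnd E A × RightEnd E B

  private
    NoneBelow⇒Lowest : ∀ P Q → IsPoint P → IsPoint Q → NoneBelow P Q → Lowest (P , Q) P
    NoneBelow⇒Lowest P Q pP pQ none C pC = none C pC ∘ height-<⇒StrictlyBelow P Q C
      {{IsPoint⇒NonZero P pP}} {{IsPoint⇒NonZero Q pQ}} {{IsPoint⇒NonZero C pC}}

    Lowest⇒NoneBelow : ∀ P Q → IsPoint P → IsPoint Q → Lowest (P , Q) P → NoneBelow P Q
    Lowest⇒NoneBelow P Q pP pQ low C pC = low C pC ∘ StrictlyBelow⇒height-< P Q C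
      {{IsPoint⇒NonZero P pP}} {{IsPoint⇒NonZero Q pQ}} {{IsPoint⇒NonZero C pC}}

  -- The invariant carried along the chain of vertices.
  LeftPointsAbove : Pt → Set (c ⊔ ℓ)
  LeftPointsAbove P = ∀ C → IsPoint C → idx C ℕ.< idx P →
                      ∀ Q → IsPoint Q → idx P ℕ.< idx Q → height (P , Q) P < height (P , Q) C

  private
    NextVertex⇒IsEdge : ∀ P Q → IsPoint P → LeftPointsAbove P → NextVertex P Q → IsEdge (P , Q)
    NextVertex⇒IsEdge P Q pP above (pQ , p<q , none , Q-last) = p<q ,
      record { isPoint = pP ; lowest = lowP ; first = λ C pC c<p → above C pC c<p Q pQ p<q } ,
      record { isPoint = pQ ; lowest = lowQ ; first = Q-first }
      where
      lowP : Lowest (P , Q) P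
      lowP = NoneBelow⇒Lowest P Q pP pQ none
      lowQ : Lowest (P , Q) Q
      lowQ C pC = lowP C pC ∘ ℚ⁺.<-respʳ-≈ (height-on-line P Q)
      Q-first : ∀ C → IsPoint C → idx Q ℕ.< idx C → height (P , Q) Q < height (P , Q) C
      Q-first C pC q<c with ℚ⁺.<-cmp (height (P , Q) Q) (height (P , Q) C)
      ... | tri< hQ<hC _ _ = hQ<hC
      ... | tri> _ _ hC<hQ = contradiction hC<hQ (lowQ C pC)
      ... | tri≈ _ hQ≈hC _ = contradiction (Lowest⇒NoneBelow P C pP pC lowPC) (Q-last C pC q<c)
        where
        -- C lies on the line PQ, so PC has the direction of PQ.
        PC∥PQ : vec P C ∥ vec P Q
        PC∥PQ = height-≈⇒∥ (P , Q) C P (ℚ⁺.≈-trans (ℚ⁺.≈-sym hQ≈hC) (height-on-line P Q))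
        lowPC : Lowest (P , C) P
        lowPC D pD = lowP D pD ∘ height-<-resp-∥ (P , C) (P , Q) D P
          (→vec P C pP (ℕ.<-trans p<q q<c)) (→vec P Q pP p<q) PC∥PQ

    NextVertex⇒LeftPointsAbove : ∀ P Q → IsPoint P → LeftPointsAbove P → NextVertex P Q → LeftPointsAbove Q
    NextVertex⇒LeftPointsAbove P Q pP above next-PQ@(pQ , p<q , _) C pC c<q S pS q<s =
      ≺⇒height-< (Q , S) Q C (convex-corner-≤< (P , Q) C Q S
        (→vec P Q pP p<q) (→vec C Q pC c<q) (→vec Q S pQ q<s)
        (ℚ⁺.≮⇒≥ (End.lowest rightQ C pC)) (End.first rightQ S pS q<s))
      where
      rightQ : RightEnd (P , Q) Q
      rightQ = proj₂ (proj₂ (NextVertex⇒IsEdge P Q pP above next-PQ))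

    Chain⇒IsEdge : ∀ {P qs} → IsPoint P → LeftPointsAbove P → Chain P qs → ∀ {E} → E ∈ edges (P ∷ qs) → IsEdge E
    Chain⇒IsEdge {P} pP above (next {Q = Q} next-PQ _) (here ≡.refl) = NextVertex⇒IsEdge P Q pP above next-PQ
    Chain⇒IsEdge {P} pP above (next {Q = Q} next-PQ@(pQ , _) chain) (there E∈) =
      Chain⇒IsEdge pQ (NextVertex⇒LeftPointsAbove P Q pP above next-PQ) chain E∈

  edges⇒IsEdge : ∀ {N E} → IsNewtonPolygon N → E ∈ edges N → IsEdge E
  edges⇒IsEdge {P ∷ _} (pP , P-first , chain) = Chain⇒IsEdge pP nothing-left chain
    where
    nothing-left : LeftPointsAbove P
    nothing-left C (Fᵢ≉0 , _) c<p = contradiction (P-first (idx C) Fᵢ≉0) (ℕ.<⇒≱ c<p)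

  module _ {D A B} (fwD : Forward D) (leftA : LeftEnd D A) (rightB : RightEnd D B) (a<b : idx A ℕ.< idx B) where
    private
      pA = End.isPoint leftA
      pB = End.isPoint rightB
      →D = Forward⇒Rightward D fwD

      lowAB : Lowest (A , B) A
      lowAB C pC = End.lowest leftA C pC ∘ height-<-resp-∥ (A , B) D C A (→vec A B pA a<b) →D AB∥D
        where
        AB∥D : vec A B ∥ direction D
        AB∥D = height-≈⇒∥ D B A (ℚ⁺.≈-sym (End-≈ leftA rightB))

      below-chord⇒¬NoneBelow : ∀ P Q C → IsPoint P → IsPoint Q → IsPoint C → idx P ℕ.< idx C → idx C ℕ.< idx Q →
        vec P C ≺ vec C Q → ¬ NoneBelow P Q
      below-chord⇒¬NoneBelow P Q C pP pQ pC p<c c<q PC≺CQ none = none C pC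
        (height-<⇒StrictlyBelow P Q C {{IsPoint⇒NonZero P pP}} {{IsPoint⇒NonZero Q pQ}} {{IsPoint⇒NonZero C pC}}
          (corner-below-chord P C Q PC≺CQ))

      next-≤-A : ∀ P Q → IsPoint P → idx P ℕ.< idx A → NextVertex P Q → idx Q ℕ.≤ idx A
      next-≤-A P Q pP p<a (pQ , _ , none , _) = ℕ.≮⇒≥ λ a<q →
        below-chord⇒¬NoneBelow P Q A pP pQ pA p<a a<q
          (convex-corner-<≤ D P A Q →D (→vec P A pP p<a) (→vec A Q pA a<q)
            (End.first leftA P pP p<a) (ℚ⁺.≮⇒≥ (End.lowest leftA Q pQ)))
          none

      next-A≡B : ∀ Q → NextVertex A Q → Q ≡ B
      next-A≡B Q (pQ , _ , none , Q-last) with ℕ.<-cmp (idx Q) (idx B)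
      ... | tri< q<b _ _ = contradiction (Lowest⇒NoneBelow A B pA pB lowAB) (Q-last B pB q<b)
      ... | tri≈ _ q≡b _ = IsPoint-unique Q B pQ pB q≡b
      ... | tri> _ _ b<q = contradiction none
        (below-chord⇒¬NoneBelow A Q B pA pQ pB a<b b<q
          (convex-corner-≤< D A B Q →D (→vec A B pA a<b) (→vec B Q pB b<q)
            (ℚ⁺.≮⇒≥ (End.lowest rightB A pA)) (End.first rightB Q pQ b<q)))

      Chain⇒∈edges : ∀ {P qs} → IsPoint P → idx P ℕ.≤ idx A → Chain P qs → (A , B) ∈ edges (P ∷ qs)
      Chain⇒∈edges pP p≤a (last P-last) =
        contradiction (P-last (idx B) (proj₁ pB)) (ℕ.<⇒≱ (ℕ.≤-<-trans p≤a a<b))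
      Chain⇒∈edges {P} pP p≤a (next {Q = Q} next-PQ@(pQ , _) chain) with ℕ.m≤n⇒m<n∨m≡n p≤a
      ... | inj₁ p<a = there (Chain⇒∈edges pQ (next-≤-A P Q pP p<a next-PQ) chain)
      ... | inj₂ p≡a with IsPoint-unique P A pP pA p≡a
      ...   | ≡.refl = here (≡.cong (A ,_) (≡.sym (next-A≡B Q next-PQ)))

    ends⇒∈edges : ∀ {N} → IsNewtonPolygon N → (A , B) ∈ edges N
    ends⇒∈edges {P ∷ _} (pP , P-first , chain) = Chain⇒∈edges pP (P-first (idx A) (proj₁ pA)) chain

  record Face (D : Edge) : Set (c ⊔ ℓ) where
    field
      {left right} : Pt
      leftEnd      : LeftEnd D left
      rightEnd     : RightEnd D right

    left≤right : idx left ℕ.≤ idx right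
    left≤right = LeftEnd≤RightEnd leftEnd rightEnd

    module _ {N} (fwD : Forward D) (N-polygon : IsNewtonPolygon N) where
      face-edge : idx left ℕ.< idx right → (left , right) ∈ edges N × SameSlope D (left , right)
      face-edge l<r =
        ends⇒∈edges fwD leftEnd rightEnd l<r N-polygon ,
        ∥⇒SameSlope D (left , right) fwD (fwd left right (End.isPoint leftEnd) l<r)
          (∥-sym (vec left right) (direction D) (height-≈⇒∥ D right left (ℚ⁺.≈-sym (End-≈ leftEnd rightEnd))))

      face-vertex : idx left ≡ idx right → NoSlopeIn D N
      face-vertex l≡r G@(A , B) G∈N same = ℕ.<-irrefl
        (≡.trans (≡.cong idx A≡left) (≡.trans l≡r (≡.cong idx (≡.sym B≡right)))) a<b
        where
        G-edge = edges⇒IsEdge N-polygon G∈N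
        a<b = proj₁ G-edge
        fwG = fwd A B (End.isPoint (proj₁ (proj₂ G-edge))) a<b
        G∥D = ∥-sym (direction D) (direction G) (SameSlope⇒∥ D G fwD fwG same)
        A≡left = End-unique (End-resp-∥ fwG fwD G∥D (proj₁ (proj₂ G-edge))) leftEnd
        B≡right = End-unique (End-resp-∥ fwG fwD G∥D (proj₂ (proj₂ G-edge))) rightEnd

  IsEdge⇒Face : ∀ {E} → IsEdge E → Face E
  IsEdge⇒Face (_ , leftA , rightB) = record { leftEnd = leftA ; rightEnd = rightB }

  Valuations : Set (c ⊔ ℓ)
  Valuations = ∀ i → coeff F i ≈ 0# ⊎ ∃ (Val p (coeff F i))

  private
    ¬¬-∀≤ : ∀ {a} {Q : ℕ → Set a} → (∀ i → ¬ ¬ Q i) → ∀ n → ¬ ¬ (∀ i → i ℕ.≤ n → Q i)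
    ¬¬-∀≤ ¬¬Q zero    ¬Q≤0 = ¬¬Q 0 λ Q0 → ¬Q≤0 λ where _ ℕ.z≤n → Q0
    ¬¬-∀≤ {Q = Q} ¬¬Q (suc n) ¬Q≤n+1 = ¬¬-∀≤ ¬¬Q n λ Q≤n → ¬¬Q (suc n) λ Qn+1 → ¬Q≤n+1 λ i i≤n+1 →
      [ (λ i<n+1 → Q≤n i (ℕ.≤-pred i<n+1)) , (λ i≡n+1 → ≡.subst Q (≡.sym i≡n+1) Qn+1) ]′ (ℕ.m≤n⇒m<n∨m≡n i≤n+1)

  ¬¬valuations : ¬ ¬ Valuations
  ¬¬valuations ¬vals = ¬¬-∀≤ ¬¬valuation (length F) (¬vals ∘ beyond-length)
    where
    open CommutativeRing R using (reflexive)
    beyond-length : (∀ i → i ℕ.≤ length F → coeff F i ≈ 0# ⊎ ∃ (Val p (coeff F i))) → Valuations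
    beyond-length vals≤ i with i ℕ.≤? length F
    ... | yes i≤len = vals≤ i i≤len
    ... | no  i≰len = inj₁ (reflexive (coeff-beyond F i (ℕ.≰⇒> i≰len)))
    ¬¬valuation : ∀ i → ¬ ¬ (coeff F i ≈ 0# ⊎ ∃ (Val p (coeff F i)))
    ¬¬valuation i ¬val = ¬¬-excluded-middle λ where
      (yes Fᵢ≈0) → ¬val (inj₁ Fᵢ≈0)
      (no  Fᵢ≉0) → ¬¬Val (coeff F i) Fᵢ≉0 (¬val ∘ inj₂)

  module _ (valuations : Valuations) where
    private
      pointsUpTo : ℕ → List Pt
      pointsUpTo zero    = []
      pointsUpTo (suc n) with valuations (suc n)
      ... | inj₁ _       = pointsUpTo n
      ... | inj₂ (v , _) = (suc n , v) ∷ pointsUpTo n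

      ∈⇒IsPoint : ∀ n {C} → C ∈ pointsUpTo n → IsPoint C
      ∈⇒IsPoint (suc n) C∈ with valuations (suc n) | C∈
      ... | inj₁ _       | C∈′         = ∈⇒IsPoint n C∈′
      ... | inj₂ (v , ν) | here ≡.refl = Val⇒≉0 {k = v} ν , ν
      ... | inj₂ _       | there C∈′   = ∈⇒IsPoint n C∈′

      IsPoint⇒∈ : ∀ n C → IsPoint C → idx C ℕ.≤ n → C ∈ pointsUpTo n
      IsPoint⇒∈ zero C pC c≤0 = contradiction (ℕ.n≤0⇒n≡0 c≤0) (ℕ.≢-nonZero⁻¹ (idx C) {{IsPoint⇒NonZero C pC}})
      IsPoint⇒∈ (suc n) C pC c≤n+1 with valuations (suc n) | ℕ.m≤n⇒m<n∨m≡n c≤n+1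
      ... | inj₁ _       | inj₁ c<n+1 = IsPoint⇒∈ n C pC (ℕ.≤-pred c<n+1)
      ... | inj₂ _       | inj₁ c<n+1 = there (IsPoint⇒∈ n C pC (ℕ.≤-pred c<n+1))
      ... | inj₁ Fₙ≈0    | inj₂ c≡n+1 = contradiction Fₙ≈0 (≡.subst (λ i → Supp F i) c≡n+1 (proj₁ pC))
      ... | inj₂ (v , ν) | inj₂ c≡n+1 = here (IsPoint-unique C (suc n , v) pC (Val⇒≉0 {k = v} ν , ν) c≡n+1)

      IsPoint⇒∈all : ∀ C → IsPoint C → C ∈ pointsUpTo (length F)
      IsPoint⇒∈all C pC = IsPoint⇒∈ (length F) C pC (Supp⇒≤length F (idx C) (proj₁ pC))

    module _ (O : IndexOrder) (D : Edge) where
      open IndexOrder.IndexOrder O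
      private
        data _⋖_ (C C′ : Pt) : Set where
          lower      : height D C < height D C′ → C ⋖ C′
          level-prior : height D C ℚ⁺.≈ height D C′ → idx C ⊏ idx C′ → C ⋖ C′

        ⋖-irrefl : ∀ {C} → ¬ C ⋖ C
        ⋖-irrefl (lower h<h)         = ℚ⁺.<-irrefl ℚ⁺.≈-refl h<h
        ⋖-irrefl (level-prior _ i⊏i) = ⊏-irrefl i⊏i

        ⋖-trans : ∀ {C₁ C₂ C₃} → C₁ ⋖ C₂ → C₂ ⋖ C₃ → C₁ ⋖ C₃
        ⋖-trans (lower h₁<h₂)             (lower h₂<h₃)             = lower (ℚ⁺.<-trans h₁<h₂ h₂<h₃)
        ⋖-trans (lower h₁<h₂)             (level-prior h₂≈h₃ _)     = lower (ℚ⁺.<-respʳ-≈ h₂≈h₃ h₁<h₂)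
        ⋖-trans (level-prior h₁≈h₂ _)     (lower h₂<h₃)             = lower (ℚ⁺.<-respˡ-≈ (ℚ⁺.≈-sym h₁≈h₂) h₂<h₃)
        ⋖-trans (level-prior h₁≈h₂ i₁⊏i₂) (level-prior h₂≈h₃ i₂⊏i₃) =
          level-prior (ℚ⁺.≈-trans h₁≈h₂ h₂≈h₃) (⊏-trans i₁⊏i₂ i₂⊏i₃)

        _⋖?_ : ∀ C C′ → Dec (C ⋖ C′)
        C ⋖? C′ with ℚ⁺.<-cmp (height D C) (height D C′) | idx C ⊏? idx C′
        ... | tri< h<h′ _ _    | _         = yes (lower h<h′)
        ... | tri≈ _ h≈h′ _    | yes i⊏i′  = yes (level-prior h≈h′ i⊏i′)
        ... | tri≈ h≮h′ _ _    | no  i⊏̸i′ = no λ { (lower h<h′) → h≮h′ h<h′ ; (level-prior _ i⊏i′) → i⊏̸i′ i⊏i′ }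
        ... | tri> h≮h′ h≉h′ _ | _         = no λ { (lower h<h′) → h≮h′ h<h′ ; (level-prior h≈h′ _) → h≉h′ h≈h′ }

      end-exists : ∃ IsPoint → ∃ (End O D)
      end-exists (C₀ , pC₀) with minimal ⋖-irrefl ⋖-trans _⋖?_ (pointsUpTo (length F)) (IsPoint⇒∈all C₀ pC₀)
      ... | A , A∈ , A-min = A , record { isPoint = pA ; lowest = lowA ; first = A-first }
        where
        pA = ∈⇒IsPoint (length F) A∈
        lowA : Lowest D A
        lowA C pC hC<hA = A-min (IsPoint⇒∈all C pC) (lower hC<hA)
        A-first : ∀ C → IsPoint C → idx C ⊏ idx A → height D A < height D C
        A-first C pC C⊏A with ℚ⁺.<-cmp (height D A) (height D C)
        ... | tri< hA<hC _ _ = hA<hC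
        ... | tri≈ _ hA≈hC _ = contradiction (level-prior (ℚ⁺.≈-sym hA≈hC) C⊏A) (A-min (IsPoint⇒∈all C pC))
        ... | tri> _ _ hC<hA = contradiction hC<hA (lowA C pC)

    face-exists : ∃ IsPoint → ∀ D → Face D
    face-exists C₀ D = record
      { leftEnd  = proj₂ (end-exists leftToRight D C₀)
      ; rightEnd = proj₂ (end-exists rightToLeft D C₀)
      }

  polygon-point : ∀ {N} → IsNewtonPolygon N → ∃ IsPoint
  polygon-point {P ∷ _} (pP , _) = P , pP

module ProductPolygon {c ℓ} (R : CommutativeRing c ℓ) (ufd : Ring.IsUFD R)
                      (p : CommutativeRing.Carrier R) (p-prime : Ring.IsPrime R p) (g h : Ring.DirPoly R) where

  open import Data.Nat as ℕ using (ℕ; suc)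
  import Data.Nat.Properties as ℕ
  open import Data.Product using (_×_; _,_; proj₁; proj₂)
  open import Data.Sum using (_⊎_; inj₁; inj₂)
  open import Relation.Nullary using (¬_)
  open import Relation.Binary.PropositionalEquality as ≡ using (_≡_)

  open CommutativeRing R using (_*_; sym; trans; zeroˡ; zeroʳ; *-cong; refl)
  open Ring R using (coeff; Val; _⊛_; _∣_) renaming (_^_ to _^ᴿ_)
  open Divisibility R
  open Valuation R ufd p p-prime using (^-∣-^; ^-∣-*; Val⇒≉0; Val-*-+)
  open DirichletProduct R using (Supp⇒≤length; coeff-⊛-∣; coeff-⊛-split)
  open module ℚ⁺ = PositiveRational using (_<_; _≤_; _·_)
  open LogPlane
  open IndexOrder
  module NP = NewtonPolygon R ufd p p-prime
  module G = NP g
  module H = NP h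
  module F = NP (g ⊛ h)

  module _ (valuations-g : G.Valuations) (valuations-h : H.Valuations) (D : Edge) (fwD : Forward D) where

    private
      term-∣ : ∀ i w j k → j ℕ.* k ≡ i →
               (∀ J K → G.IsPoint J → H.IsPoint K → idx J ≡ j → idx K ≡ k →
                  height D (i , w) < height D J · height D K) →
               (p ^ᴿ suc w) ∣ (coeff g j * coeff h k)
      term-∣ i w j k jk≡i above with valuations-g j | valuations-h k
      ... | inj₁ gⱼ≈0 | _ = ∣-respʳ (sym (trans (*-cong gⱼ≈0 refl) (zeroˡ _))) (∣0 _)
      ... | inj₂ _ | inj₁ hₖ≈0 = ∣-respʳ (sym (trans (*-cong refl hₖ≈0) (zeroʳ _))) (∣0 _)
      ... | inj₂ (u , νⱼ) | inj₂ (v , νₖ) =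
        ∣-trans (^-∣-^ w<u+v) (^-∣-* {u} {v} (proj₁ νⱼ) (proj₁ νₖ))
        where
        pJ : G.IsPoint (j , u)
        pJ = Val⇒≉0 {k = u} νⱼ , νⱼ
        pK : H.IsPoint (k , v)
        pK = Val⇒≉0 {k = v} νₖ , νₖ
        w<u+v : w ℕ.< u ℕ.+ v
        w<u+v = height-val-< D i w (u ℕ.+ v) (Forward⇒Rightward D fwD)
          (ℚ⁺.<-respʳ-≈ (ℚ⁺.≈-sym (≡.subst (λ t → height D (t , u ℕ.+ v) ℚ⁺.≈ _) jk≡i
                                   (height-⊙ D (j , u) (k , v) {{G.IsPoint⇒NonZero (j , u) pJ}} {{H.IsPoint⇒NonZero (k , v) pK}})))
                        (above (j , u) (k , v) pJ pK ≡.refl ≡.refl))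

      -- Otherwise p^(w+1) would divide every term of its coefficient.
      ¬below-all : ∀ C → F.IsPoint C →
        ¬ (∀ J K → G.IsPoint J → H.IsPoint K → idx J ℕ.* idx K ≡ idx C → height D C < height D J · height D K)
      ¬below-all C@(i , w) (_ , νᵢ) below = proj₂ νᵢ (coeff-⊛-∣ g h i λ j k jk≡i →
        term-∣ i w j k jk≡i λ J K pJ pK J≡j K≡k →
          below J K pJ pK (≡.trans (≡.cong₂ ℕ._*_ J≡j K≡k) jk≡i))

      -- The coefficient is g_a h_b plus terms divisible by p^(u+v+1).
      ⊙-IsPoint : ∀ A B → G.IsPoint A → H.IsPoint B →
        (∀ J K → G.IsPoint J → H.IsPoint K → idx J ℕ.* idx K ≡ idx A ℕ.* idx B → ¬ (idx J ≡ idx A × idx K ≡ idx B) →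
           height D (A ⊙ B) < height D J · height D K) →
        F.IsPoint (A ⊙ B)
      ⊙-IsPoint A@(a , u) B@(b , v) pA@(gₐ≉0 , νₐ) pB@(hᵦ≉0 , νᵦ) below-others
        with coeff-⊛-split g h a b {{G.IsPoint⇒NonZero A pA}} {{H.IsPoint⇒NonZero B pB}}
               (ℕ.*-mono-≤ (Supp⇒≤length g a gₐ≉0) (Supp⇒≤length h b hᵦ≉0))
               (λ j k jk≡ab jk≢ab → term-∣ (a ℕ.* b) (u ℕ.+ v) j k jk≡ab λ J K pJ pK J≡j K≡k →
                 below-others J K pJ pK (≡.trans (≡.cong₂ ℕ._*_ J≡j K≡k) jk≡ab)
                   λ (J≡a , K≡b) → jk≢ab (≡.trans (≡.sym J≡j) J≡a , ≡.trans (≡.sym K≡k) K≡b))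
      ... | r , fₐᵦ≈gₐhᵦ+r , pᵘ⁺ᵛ⁺¹∣r = Val⇒≉0 {k = u ℕ.+ v} νₐᵦ , νₐᵦ
        where
        νₐᵦ : Val p (coeff (g ⊛ h) (a ℕ.* b)) (u ℕ.+ v)
        νₐᵦ = Val-*-+ {i = u} {v} νₐ νᵦ fₐᵦ≈gₐhᵦ+r pᵘ⁺ᵛ⁺¹∣r

    End-⊙ : ∀ O {A B} → G.End O D A → H.End O D B → F.End O D (A ⊙ B)
    End-⊙ O {A@(a , u)} {B@(b , v)} endA endB = record { isPoint = pAB ; lowest = lowAB ; first = AB-first }
      where
      open IndexOrder.IndexOrder O
      pA = G.End.isPoint endA
      pB = H.End.isPoint endB
      split : height D (A ⊙ B) ℚ⁺.≈ height D A · height D B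
      split = height-⊙ D A B {{G.IsPoint⇒NonZero A pA}} {{H.IsPoint⇒NonZero B pB}}
      ≤-all : ∀ J K → G.IsPoint J → H.IsPoint K → height D A · height D B ≤ height D J · height D K
      ≤-all J K pJ pK = ℚ⁺.·-mono-≤ (ℚ⁺.≮⇒≥ (G.End.lowest endA J pJ)) (ℚ⁺.≮⇒≥ (H.End.lowest endB K pK))
      <-prior : ∀ J K → G.IsPoint J → H.IsPoint K → idx J ⊏ a ⊎ idx K ⊏ b →
                height D A · height D B < height D J · height D K
      <-prior J K pJ pK (inj₁ J⊏A) = ℚ⁺.·-mono-<-≤ (G.End.first endA J pJ J⊏A) (ℚ⁺.≮⇒≥ (H.End.lowest endB K pK))
      <-prior J K pJ pK (inj₂ K⊏B) = ℚ⁺.·-mono-≤-< (ℚ⁺.≮⇒≥ (G.End.lowest endA J pJ)) (H.End.first endB K pK K⊏B)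
      pAB : F.IsPoint (A ⊙ B)
      pAB = ⊙-IsPoint A B pA pB λ J K pJ pK jk≡ab jk≢ab → ℚ⁺.<-respˡ-≈ (ℚ⁺.≈-sym split) (<-prior J K pJ pK
        (*-split-≡ {{G.IsPoint⇒NonZero J pJ}} {{H.IsPoint⇒NonZero K pK}}
                   {{G.IsPoint⇒NonZero A pA}} {{H.IsPoint⇒NonZero B pB}} jk≡ab jk≢ab))
      lowAB : F.Lowest D (A ⊙ B)
      lowAB C pC hC<hAB = ¬below-all C pC λ J K pJ pK _ →
        ℚ⁺.<-≤-trans (ℚ⁺.<-respʳ-≈ split hC<hAB) (≤-all J K pJ pK)
      AB-first : ∀ C → F.IsPoint C → idx C ⊏ a ℕ.* b → height D (A ⊙ B) < height D C
      AB-first C pC C⊏AB = ℚ⁺.≰⇒> λ hC≤hAB → ¬below-all C pC λ J K pJ pK jk≡c →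
        ℚ⁺.≤-<-trans (ℚ⁺.≤-trans hC≤hAB (ℚ⁺.≤-reflexive split))
          (<-prior J K pJ pK (*-split-⊏ (≡.subst (_⊏ a ℕ.* b) (≡.sym jk≡c) C⊏AB)))

    face-⊛ : G.Face D → H.Face D → F.Face D
    face-⊛ faceG faceH = record
      { leftEnd  = End-⊙ leftToRight (G.Face.leftEnd faceG) (H.Face.leftEnd faceH)
      ; rightEnd = End-⊙ rightToLeft (G.Face.rightEnd faceG) (H.Face.rightEnd faceH)
      }

open import Data.Nat as ℕ using (ℕ)
import Data.Nat.Properties as ℕ
import Data.Integer as ℤ
open import Data.Product using (∃-syntax; _×_; _,_; proj₁; proj₂)
open import Data.Sum using (_⊎_; inj₁; inj₂)
open import Data.List.Membership.Propositional using (_∈_; find; lose)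
open import Data.List.Relation.Unary.Any using (any?)
open import Relation.Nullary using (Dec; ¬?; contradiction)
open import Relation.Nullary.Decidable using (map′; _×-dec_; _⊎-dec_; decidable-stable)
open import Relation.Nullary.Negation using (Stable; ¬¬-map)
open import Relation.Binary.PropositionalEquality as ≡ using (_≡_)
open import Function using (_∘_)
open LogPlane using (Forward; _⊙_; VecSum-⊙; VecEq-⊙ʳ; VecEq-⊙ˡ)

private
  ∃∈? : ∀ {a p} {A : Set a} {P : A → Set p} → (∀ x → Dec (P x)) → ∀ xs → Dec (∃[ x ] (x ∈ xs × P x))
  ∃∈? P? xs = map′ find (λ (_ , x∈ , px) → lose x∈ px) (any? P? xs)

  SameSlope? : ∀ E G → Dec (SameSlope E G)
  SameSlope? (_ , _) (_ , _) = _ ℕ.≟ _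

  SlopeIn? : ∀ E N → Dec (SlopeIn E N)
  SlopeIn? E N = ∃∈? (SameSlope? E) (edges N)

  NoSlopeIn? : ∀ E N → Dec (NoSlopeIn E N)
  NoSlopeIn? E N = map′ (λ ¬slope G G∈ same → ¬slope (G , G∈ , same)) (λ none (G , G∈ , same) → none G G∈ same)
                        (¬? (SlopeIn? E N))

  VecEq? : ∀ E G → Dec (VecEq E G)
  VecEq? (_ , _) (_ , _) = (_ ℕ.≟ _) ×-dec (_ ℤ.≟ _)

  VecSum? : ∀ E G H → Dec (VecSum E G H)
  VecSum? (_ , _) (_ , _) (_ , _) = (_ ℕ.≟ _) ×-dec (_ ℤ.≟ _)

-- The last conjunct of PolygonSum, for one edge E of the polygon of the product.
EdgeSum : List Pt → List Pt → Edge → Set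
EdgeSum Ng Nh E =
    (∃[ G ] ∃[ H ] (G ∈ edges Ng × SameSlope E G × H ∈ edges Nh × SameSlope E H × VecSum E G H))
  ⊎ (∃[ G ] (G ∈ edges Ng × SameSlope E G × NoSlopeIn E Nh × VecEq E G))
  ⊎ (∃[ H ] (H ∈ edges Nh × SameSlope E H × NoSlopeIn E Ng × VecEq E H))

private
  EdgeSum? : ∀ Ng Nh E → Dec (EdgeSum Ng Nh E)
  EdgeSum? Ng Nh E =
    map′ (λ (G , G∈ , sG , H , H∈ , sH , sum) → G , H , G∈ , sG , H∈ , sH , sum)
         (λ (G , H , G∈ , sG , H∈ , sH , sum) → G , G∈ , sG , H , H∈ , sH , sum)
         (∃∈? (λ G → SameSlope? E G ×-dec ∃∈? (λ H → SameSlope? E H ×-dec VecSum? E G H) (edges Nh)) (edges Ng))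
    ⊎-dec ∃∈? (λ G → SameSlope? E G ×-dec NoSlopeIn? E Nh ×-dec VecEq? E G) (edges Ng)
    ⊎-dec ∃∈? (λ H → SameSlope? E H ×-dec NoSlopeIn? E Ng ×-dec VecEq? E H) (edges Nh)

  ∀∈-stable : ∀ {a p} {A : Set a} {P : A → Set p} → (∀ x → Dec (P x)) → ∀ xs → Stable (∀ x → x ∈ xs → P x)
  ∀∈-stable P? xs ¬¬∀P x x∈ = decidable-stable (P? x) (¬¬-map (λ ∀P → ∀P x x∈) ¬¬∀P)

  PolygonSum-stable : ∀ Nf Ng Nh → Stable (PolygonSum Nf Ng Nh)
  PolygonSum-stable Nf Ng Nh ¬¬sum =
    ∀∈-stable (λ E → SlopeIn? E Ng ⊎-dec SlopeIn? E Nh) (edges Nf) (¬¬-map proj₁ ¬¬sum) ,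
    ∀∈-stable (λ G → SlopeIn? G Nf) (edges Ng) (¬¬-map (proj₁ ∘ proj₂) ¬¬sum) ,
    ∀∈-stable (λ H → SlopeIn? H Nf) (edges Nh) (¬¬-map (proj₁ ∘ proj₂ ∘ proj₂) ¬¬sum) ,
    ∀∈-stable (EdgeSum? Ng Nh) (edges Nf) (¬¬-map (proj₂ ∘ proj₂ ∘ proj₂) ¬¬sum)

module _ {c ℓ} (R : CommutativeRing c ℓ) (ufd : Ring.IsUFD R)
         (p : CommutativeRing.Carrier R) (p-prime : Ring.IsPrime R p) (g h : Ring.DirPoly R)
         {Nf Ng Nh : List Pt}
         (polygon-f : Ring.Newton.IsNewtonPolygon R p (Ring._⊛_ R g h) Nf)
         (polygon-g : Ring.Newton.IsNewtonPolygon R p g Ng)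
         (polygon-h : Ring.Newton.IsNewtonPolygon R p h Nh) where

  open ProductPolygon R ufd p p-prime g h

  module _ (valuations-g : G.Valuations) (valuations-h : H.Valuations) where
    private
      faceG : ∀ D → G.Face D
      faceG = G.face-exists valuations-g (G.polygon-point polygon-g)

      faceH : ∀ D → H.Face D
      faceH = H.face-exists valuations-h (H.polygon-point polygon-h)

      slopeIn-product : ∀ D → Forward D → (fg : G.Face D) (fh : H.Face D) →
        idx (G.Face.left fg ⊙ H.Face.left fh) ℕ.< idx (G.Face.right fg ⊙ H.Face.right fh) → SlopeIn D Nf
      slopeIn-product D fwD fg fh l<r =
        _ , F.Face.face-edge (face-⊛ valuations-g valuations-h D fwD fg fh) fwD polygon-f l<r

      IsEdge⇒Forward : ∀ {E} → F.IsEdge E → Forward E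
      IsEdge⇒Forward {A , B} (a<b , leftA , _) = F.IsPoint⇒NonZero A (F.End.isPoint leftA) , a<b

    slopeIn-g : ∀ G → G ∈ edges Ng → SlopeIn G Nf
    slopeIn-g G@(A , B) G∈ = slopeIn-product G fwG (G.IsEdge⇒Face G-edge) fh
      (ℕ.<-≤-trans (ℕ.*-monoˡ-< (idx (H.Face.left fh)) {{H.IsPoint⇒NonZero (H.Face.left fh) (H.End.isPoint (H.Face.leftEnd fh))}} a<b)
                   (ℕ.*-monoʳ-≤ (idx B) (H.Face.left≤right fh)))
      where
      G-edge = G.edges⇒IsEdge polygon-g G∈
      a<b = proj₁ G-edge
      fwG = G.IsPoint⇒NonZero A (G.End.isPoint (proj₁ (proj₂ G-edge))) , a<b
      fh = faceH G

    slopeIn-h : ∀ H → H ∈ edges Nh → SlopeIn H Nf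
    slopeIn-h H@(A , B) H∈ = slopeIn-product H fwH fg (H.IsEdge⇒Face H-edge)
      (ℕ.≤-<-trans (ℕ.*-monoˡ-≤ (idx A) (G.Face.left≤right fg))
                   (ℕ.*-monoʳ-< (idx (G.Face.right fg)) {{G.IsPoint⇒NonZero (G.Face.right fg) (G.End.isPoint (G.Face.rightEnd fg))}} a<b))
      where
      H-edge = H.edges⇒IsEdge polygon-h H∈
      a<b = proj₁ H-edge
      fwH = H.IsPoint⇒NonZero A (H.End.isPoint (proj₁ (proj₂ H-edge))) , a<b
      fg = faceG H

    -- An edge E of the polygon of g ⊛ h joins the products of the ends of the faces of g and h.
    module _ {A B} (E∈ : (A , B) ∈ edges Nf) where
      private
        E = (A , B)
        E-edge = F.edges⇒IsEdge polygon-f E∈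
        fwE = IsEdge⇒Forward E-edge
        fg = faceG E
        fh = faceH E
        open G.Face fg using () renaming (left to Lg; right to Rg)
        open H.Face fh using () renaming (left to Lh; right to Rh)

        A≡ : A ≡ Lg ⊙ Lh
        A≡ = F.End-unique (proj₁ (proj₂ E-edge)) (F.Face.leftEnd (face-⊛ valuations-g valuations-h E fwE fg fh))
        B≡ : B ≡ Rg ⊙ Rh
        B≡ = F.End-unique (proj₂ (proj₂ E-edge)) (F.Face.rightEnd (face-⊛ valuations-g valuations-h E fwE fg fh))

        vecSum : VecSum E (Lg , Rg) (Lh , Rh)
        vecSum = ≡.subst₂ (λ A′ B′ → VecSum (A′ , B′) (Lg , Rg) (Lh , Rh)) (≡.sym A≡) (≡.sym B≡) (VecSum-⊙ Lg Lh Rg Rh)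

        vecEq-g : Lh ≡ Rh → VecEq E (Lg , Rg)
        vecEq-g Lh≡Rh = ≡.subst₂ (λ A′ B′ → VecEq (A′ , B′) (Lg , Rg))
          (≡.sym A≡) (≡.sym (≡.trans B≡ (≡.cong (Rg ⊙_) (≡.sym Lh≡Rh)))) (VecEq-⊙ʳ Lg Rg Lh)

        vecEq-h : Lg ≡ Rg → VecEq E (Lh , Rh)
        vecEq-h Lg≡Rg = ≡.subst₂ (λ A′ B′ → VecEq (A′ , B′) (Lh , Rh))
          (≡.sym A≡) (≡.sym (≡.trans B≡ (≡.cong (_⊙ Rh) (≡.sym Lg≡Rg)))) (VecEq-⊙ˡ Lg Lh Rh)

        Lg≡Rg : idx Lg ≡ idx Rg → Lg ≡ Rg
        Lg≡Rg = G.IsPoint-unique Lg Rg (G.End.isPoint (G.Face.leftEnd fg)) (G.End.isPoint (G.Face.rightEnd fg))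

        Lh≡Rh : idx Lh ≡ idx Rh → Lh ≡ Rh
        Lh≡Rh = H.IsPoint-unique Lh Rh (H.End.isPoint (H.Face.leftEnd fh)) (H.End.isPoint (H.Face.rightEnd fh))

        edge-g = G.Face.face-edge fg fwE polygon-g
        edge-h = H.Face.face-edge fh fwE polygon-h

        cases : idx Lg ℕ.< idx Rg ⊎ idx Lg ≡ idx Rg → idx Lh ℕ.< idx Rh ⊎ idx Lh ≡ idx Rh → EdgeSum Ng Nh E
        cases (inj₁ lg<rg) (inj₁ lh<rh) = inj₁ ((Lg , Rg) , (Lh , Rh) ,
          proj₁ (edge-g lg<rg) , proj₂ (edge-g lg<rg) , proj₁ (edge-h lh<rh) , proj₂ (edge-h lh<rh) , vecSum)
        cases (inj₁ lg<rg) (inj₂ lh≡rh) = inj₂ (inj₁ ((Lg , Rg) , proj₁ (edge-g lg<rg) , proj₂ (edge-g lg<rg) ,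
          H.Face.face-vertex fh fwE polygon-h lh≡rh , vecEq-g (Lh≡Rh lh≡rh)))
        cases (inj₂ lg≡rg) (inj₁ lh<rh) = inj₂ (inj₂ ((Lh , Rh) , proj₁ (edge-h lh<rh) , proj₂ (edge-h lh<rh) ,
          G.Face.face-vertex fg fwE polygon-g lg≡rg , vecEq-h (Lg≡Rg lg≡rg)))
        cases (inj₂ lg≡rg) (inj₂ lh≡rh) = contradiction
          (≡.trans (≡.cong idx A≡) (≡.trans (≡.cong₂ ℕ._*_ lg≡rg lh≡rh) (≡.sym (≡.cong idx B≡))))
          (ℕ.<⇒≢ (proj₁ E-edge))

      edge-sum : EdgeSum Ng Nh E
      edge-sum = cases (ℕ.m≤n⇒m<n∨m≡n (G.Face.left≤right fg)) (ℕ.m≤n⇒m<n∨m≡n (H.Face.left≤right fh))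

    polygonSum-from-valuations : PolygonSum Nf Ng Nh
    polygonSum-from-valuations = slopeIn-g-or-h , slopeIn-g , slopeIn-h , λ E E∈ → edge-sum E∈
      where
      slopeIn-g-or-h : ∀ E → E ∈ edges Nf → SlopeIn E Ng ⊎ SlopeIn E Nh
      slopeIn-g-or-h E E∈ with edge-sum E∈
      ... | inj₁ (G , _ , G∈ , sameG , _)      = inj₁ (G , G∈ , sameG)
      ... | inj₂ (inj₁ (G , G∈ , sameG , _))   = inj₁ (G , G∈ , sameG)
      ... | inj₂ (inj₂ (H , H∈ , sameH , _))   = inj₂ (H , H∈ , sameH)

  -- Valuations exist only classically, but the conclusion is decidable.
  polygonSum : PolygonSum Nf Ng Nh
  polygonSum = PolygonSum-stable Nf Ng Nh λ ¬sum →
    G.¬¬valuations λ valuations-g → H.¬¬valuations λ valuations-h →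
      ¬sum (polygonSum-from-valuations valuations-g valuations-h)

theorem3p1 : ∀ {c ℓ : Level} (R : CommutativeRing c ℓ) → Ring.IsUFD R →
    (p : CommutativeRing.Carrier R) → Ring.IsPrime R p →
    (g h : Ring.DirPoly R) →
    Ring.NonConstant R g → Ring.AlgPrimitive R g →
    Ring.NonConstant R h → Ring.AlgPrimitive R h →
    (Nf Ng Nh : List Pt) →
    Ring.Newton.IsNewtonPolygon R p (Ring._⊛_ R g h) Nf →
    Ring.Newton.IsNewtonPolygon R p g Ng →
    Ring.Newton.IsNewtonPolygon R p h Nh →
    PolygonSum Nf Ng Nh
theorem3p1 R ufd p p-prime g h _ _ _ _ Nf Ng Nh polygon-f polygon-g polygon-h =
  polygonSum R ufd p p-prime g h polygon-f polygon-g polygon-h
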